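{- Let $a_n$ be the number of chains in $\mathcal{WOC}(n)$ that do not contain the stopping condition $x_{i_1}\le x_{i_2}\le x_{i_3}$ with $i_1<i_2<i_3$ (the active leaves). Then $a_n$ equals the number of Dyck paths of semilength $n$ in which each occurrence of the subpath $\mathsf{UDD}$ is colored with one of two colors (i.e. $\sum_P 2^{u(P)}$ over Dyck paths $P$ of semilength $n$, where $u(P)$ is the number of occurrences of $\mathsf{UDD}$ in $P$); in fact there is a bijection between these two sets. The generating function $A(x)=\sum_{n\ge1}a_nx^n$ satisfies \[ 1+A(x)=\frac{1-\sqrt{1-4x-4x^2}}{2x(1+x)}=C(x(1+x)), \] where $C(x)=\frac{1-\sqrt{1-4x}}{2x}$ is the Catalan generating function, and hence $a_n=\sum_{j=0}^{n}\binom{n-j}{j}C_{n-j}$ with $C_m$ the $m$-th Catalan number. The sequence starts $1,3,9,31,113,431,1697,6847,\dots$.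
   Context: A weak-ordering chain on $x_1,\dots,x_n$ is an expression $x_{i_1}\,\mathrm{op}\,x_{i_2}\,\mathrm{op}\cdots\mathrm{op}\,x_{i_n}$, where $(i_1,\dots,i_n)$ is an ordering of $[n]$ and each $\mathrm{op}$ is $<$ or $=$; expressions defining the same ordered set partition of $[n]$ are identified. $\mathcal{WOC}(n)$ is the set of these chains. A chain contains the stopping condition $x_{i_1}\le x_{i_2}\le x_{i_3}$ with $i_1<i_2<i_3$ if there exist indices $i_1<i_2<i_3$ such that in the chain each of $x_{i_1}\le x_{i_2}$ and $x_{i_2}\le x_{i_3}$ holds (each being $<$ or $=$). A Dyck path of semilength $n$ is a lattice path from $(0,0)$ to $(2n,0)$ with steps $\mathsf{U}=(1,1)$ and $\mathsf{D}=(1,-1)$ never going below the $x$-axis. -}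

module Defs where

open import Data.Bool using (Bool; true; false; _∧_; _∨_; not; T)
open import Data.Nat using (ℕ; zero; suc; _+_; _*_; _∸_; _<ᵇ_; _≤ᵇ_; _≡ᵇ_; _/_)
open import Data.Nat.Combinatorics using (_C_)
open import Data.List using (List; []; _∷_; upTo; length)
open import Data.Bool.ListAction using (any; all)
open import Data.Vec using (Vec; toList)
open import Data.Product using (Σ; proj₁)

-- Weak-ordering chains on x_1..x_n  =  ordered set partitions of [n].
-- A chain is encoded by its "block vector" b : Vec ℕ n, where b_i is the
-- position (0-based) of the block containing x_i in the chain, so that
--   x_i < x_j  iff  b_i < b_j,   x_i = x_j  iff  b_i = b_j.
-- b encodes an ordered set partition iff the set of used values is an
-- initial segment {0,…,k-1} of ℕ; this makes the encoding canonical
-- (one vector per element of WOC(n)).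

isOrderedSetPartition : (n : ℕ) → List ℕ → Bool
isOrderedSetPartition n xs =
  all (λ x → x <ᵇ n) xs
  ∧ all (λ v → any (λ x → x ≡ᵇ v) xs ∨ all (λ x → x <ᵇ v) xs) (upTo n)

hasUp2From : ℕ → List ℕ → Bool
hasUp2From x [] = false
hasUp2From x (y ∷ ys) = ((x ≤ᵇ y) ∧ any (λ z → y ≤ᵇ z) ys) ∨ hasUp2From x ys

containsStop : List ℕ → Bool
containsStop [] = false
containsStop (x ∷ xs) = hasUp2From x xs ∨ containsStop xs

ActiveChain : ℕ → Set
ActiveChain n =
  Σ (Vec ℕ n) (λ b → T (isOrderedSetPartition n (toList b) ∧ not (containsStop (toList b))))

data Step : Set where
  U D : Step

dyckFrom : ℕ → List Step → Bool
dyckFrom zero [] = true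
dyckFrom (suc h) [] = false
dyckFrom h (U ∷ s) = dyckFrom (suc h) s
dyckFrom zero (D ∷ s) = false
dyckFrom (suc h) (D ∷ s) = dyckFrom h s

isDyckOfSemilength : ℕ → List Step → Bool
isDyckOfSemilength n p = (length p ≡ᵇ 2 * n) ∧ dyckFrom 0 p

DyckPath : ℕ → Set
DyckPath n = Σ (List Step) (λ p → T (isDyckOfSemilength n p))

countUDD : List Step → ℕ
countUDD (U ∷ D ∷ D ∷ s) = suc (countUDD (D ∷ D ∷ s))
countUDD (_ ∷ s) = countUDD s
countUDD [] = 0

ColoredDyckPath : ℕ → Set
ColoredDyckPath n = Σ (DyckPath n) (λ P → Vec Bool (countUDD (proj₁ P)))

catalan : ℕ → ℕ
catalan m = ((2 * m) C m) / suc m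

sumTo : ℕ → (ℕ → ℕ) → ℕ
sumTo zero f = f 0
sumTo (suc n) f = sumTo n f + f (suc n)

aFormula : ℕ → ℕ
aFormula n = sumTo n (λ j → ((n ∸ j) C j) * catalan (n ∸ j))

-- Both sets are counted by a_n = Σ_k C(n − k, k) C_{n−k}, so a bijection exists.
--
-- A marked UDD of a colored path behaves like a single down step.  Hence the paths of
-- semilength n with k marked UDDs are the Dyck paths of semilength n − k in which k of the
-- n − k down steps have been expanded into marked UDDs: C(n − k, k) C_{n−k} of them.
--
-- A chain is encoded by its block vector w, a word over the letters 0, …, m − 1 using all
-- of them.  Avoiding the stopping condition forces the largest letter to occur at most twice:
-- once inside the initial strictly decreasing run, and possibly a second time at the front.
-- Deleting it gives a recursion in m, the number k = n − m of repeated letters and the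
-- length d of the initial run; its solution is C(m, k) times a ballot number, and summing
-- the ballot numbers over d gives C_m.

module Submission where

open import Defs
open import Axiom.UniquenessOfIdentityProofs using (module Decidable⇒UIP)
open import Data.Bool using (Bool; true; false; T; _∧_; _∨_; not; if_then_else_)
import Data.Bool.Properties as Bool
open import Data.Bool.Properties using (T-irrelevant; T-≡; T-∧; T-∨; T-not-≡; ∧-comm; ∧-zeroʳ; ∨-conicalˡ; ∨-conicalʳ)
open import Data.Bool.ListAction using (any; all)
open import Data.Empty using (⊥; ⊥-elim)
open import Data.Fin using (Fin)
import Data.Fin as Fin
open import Data.Fin.Properties using (+↔⊎)
open import Data.List using (List; []; _∷_; length; upTo; map)
open import Data.List.Relation.Unary.All as All using (All; []; _∷_)
open import Data.List.Relation.Unary.All.Properties using (all⁺; all⁻; applyUpTo⁺₁; applyUpTo⁻)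
open import Data.Nat
open import Data.Nat.Combinatorics using (_C_; nCk≡nC[n∸k]; nCk+nC[k+1]≡[n+1]C[k+1]; k>n⇒nCk≡0; nC1≡n)
open import Data.Nat.DivMod using (m*n/n≡m)
open import Data.Nat.Properties
open import Data.Nat.Tactic.RingSolver using (solve-∀)
open import Data.Product using (Σ; _×_; _,_; proj₁; proj₂)
open import Data.Sum using (_⊎_; inj₁; inj₂)
open import Data.Sum.Function.Propositional using (_⊎-cong_)
open import Data.Vec using (Vec; []; _∷_; count; toList)
open import Data.Vec.Properties using (count≤n; length-toList)
open import Function.Bundles using (_↔_; mk↔ₛ′; Equivalence)
open import Function.Properties.Inverse using (↔-trans; ↔-sym)
open import Relation.Binary.PropositionalEquality
open import Relation.Nullary using (¬_; yes; no)
open import Relation.Nullary.Decidable using (T?)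

open ≡-Reasoning

T⇒≡true : ∀ {b} → T b → b ≡ true
T⇒≡true = Equivalence.to T-≡

≡true⇒T : ∀ {b} → b ≡ true → T b
≡true⇒T = Equivalence.from T-≡

T∧ : ∀ {a b} → T a → T b → T (a ∧ b)
T∧ ta tb = Equivalence.from T-∧ (ta , tb)

T∧ˡ : ∀ a {b} → T (a ∧ b) → T a
T∧ˡ a t = proj₁ (Equivalence.to (T-∧ {a}) t)

T∧ʳ : ∀ a {b} → T (a ∧ b) → T b
T∧ʳ a t = proj₂ (Equivalence.to (T-∧ {a}) t)

∨≡false : ∀ {a b} → a ≡ false → b ≡ false → a ∨ b ≡ false
∨≡false refl refl = refl

≡ᵇ-refl : ∀ n → (n ≡ᵇ n) ≡ true
≡ᵇ-refl zero    = refl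
≡ᵇ-refl (suc n) = ≡ᵇ-refl n

<⇒≡ᵇ≡false : ∀ {m n} → m < n → (m ≡ᵇ n) ≡ false
<⇒≡ᵇ≡false {zero}  {suc n} _         = refl
<⇒≡ᵇ≡false {suc m} {suc n} (s≤s m<n) = <⇒≡ᵇ≡false m<n

≢⇒≡ᵇ≡false : ∀ m n → m ≢ n → (m ≡ᵇ n) ≡ false
≢⇒≡ᵇ≡false m n m≢n with m ≡ᵇ n in eq
... | true  = ⊥-elim (m≢n (≡ᵇ⇒≡ m n (≡true⇒T eq)))
... | false = refl

<⇒<ᵇ≡true : ∀ {m n} → m < n → (m <ᵇ n) ≡ true
<⇒<ᵇ≡true m<n = T⇒≡true (<⇒<ᵇ m<n)

≤⇒<ᵇ≡false : ∀ {m n} → n ≤ m → (m <ᵇ n) ≡ false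
≤⇒<ᵇ≡false {m}     {zero}  _         = refl
≤⇒<ᵇ≡false {suc m} {suc n} (s≤s n≤m) = ≤⇒<ᵇ≡false n≤m

<⇒≤ᵇ≡false : ∀ {m n} → n < m → (m ≤ᵇ n) ≡ false
<⇒≤ᵇ≡false {suc m} (s≤s n≤m) = ≤⇒<ᵇ≡false n≤m

≤⇒≤ᵇ≡true : ∀ {m n} → m ≤ n → (m ≤ᵇ n) ≡ true
≤⇒≤ᵇ≡true m≤n = T⇒≡true (≤⇒≤ᵇ m≤n)

⊎↔Fin+ : ∀ {A B : Set} {a b} → A ↔ Fin a → B ↔ Fin b → (A ⊎ B) ↔ Fin (a + b)
⊎↔Fin+ f g = ↔-trans (f ⊎-cong g) (↔-sym +↔⊎)

¬⇒↔Fin0 : ∀ {A : Set} → ¬ A → A ↔ Fin 0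
¬⇒↔Fin0 ¬a = mk↔ₛ′ (λ a → ⊥-elim (¬a a)) (λ ()) (λ ()) (λ a → ⊥-elim (¬a a))

Σ≤suc↔⊎ : ∀ {Y : ℕ → Set} m → Σ ℕ (λ d → d ≤ suc m × Y d) ↔ (Σ ℕ (λ d → d ≤ m × Y d) ⊎ Y (suc m))
Σ≤suc↔⊎ {Y} m = mk↔ₛ′ split join split∘join join∘split
  where
  split : Σ ℕ (λ d → d ≤ suc m × Y d) → Σ ℕ (λ d → d ≤ m × Y d) ⊎ Y (suc m)
  split (d , d≤1+m , y) with m≤n⇒m<n∨m≡n d≤1+m
  ... | inj₁ d<1+m = inj₁ (d , ≤-pred d<1+m , y)
  ... | inj₂ refl  = inj₂ y
  join : Σ ℕ (λ d → d ≤ m × Y d) ⊎ Y (suc m) → Σ ℕ (λ d → d ≤ suc m × Y d)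
  join (inj₁ (d , d≤m , y)) = d , m≤n⇒m≤1+n d≤m , y
  join (inj₂ y)             = suc m , ≤-refl , y
  split∘join : ∀ x → split (join x) ≡ x
  split∘join (inj₁ (d , d≤m , y)) with m≤n⇒m<n∨m≡n (m≤n⇒m≤1+n d≤m)
  ... | inj₁ d<1+m = cong (λ p → inj₁ (d , p , y)) (≤-irrelevant _ _)
  ... | inj₂ refl  = ⊥-elim (1+n≰n d≤m)
  split∘join (inj₂ y) with m≤n⇒m<n∨m≡n (≤-refl {suc m})
  ... | inj₁ 1+m<1+m = ⊥-elim (1+n≰n (≤-pred 1+m<1+m))
  ... | inj₂ refl    = refl
  join∘split : ∀ x → join (split x) ≡ x
  join∘split (d , d≤1+m , y) with m≤n⇒m<n∨m≡n d≤1+m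
  ... | inj₁ d<1+m = cong (λ p → d , p , y) (≤-irrelevant _ _)
  ... | inj₂ refl  = cong (λ p → suc m , p , y) (≤-irrelevant _ _)

Σ≤↔Fin-sumTo : ∀ {Y : ℕ → Set} {g : ℕ → ℕ} m → (∀ d → Y d ↔ Fin (g d)) →
               Σ ℕ (λ d → d ≤ m × Y d) ↔ Fin (sumTo m g)
Σ≤↔Fin-sumTo {Y} zero φ = ↔-trans Σ≤0↔ (φ 0)
  where
  Σ≤0↔ : Σ ℕ (λ d → d ≤ 0 × Y d) ↔ Y 0
  Σ≤0↔ = mk↔ₛ′ (λ { (zero , z≤n , y) → y }) (λ y → 0 , z≤n , y) (λ _ → refl) (λ { (zero , z≤n , y) → refl })
Σ≤↔Fin-sumTo (suc m) φ = ↔-trans (Σ≤suc↔⊎ m) (⊎↔Fin+ (Σ≤↔Fin-sumTo m φ) (φ (suc m)))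

sumTo-cong : ∀ n {g h : ℕ → ℕ} → (∀ k → k ≤ n → g k ≡ h k) → sumTo n g ≡ sumTo n h
sumTo-cong zero    e = e 0 z≤n
sumTo-cong (suc n) e = cong₂ _+_ (sumTo-cong n (λ k k≤n → e k (m≤n⇒m≤1+n k≤n))) (e (suc n) ≤-refl)

sumTo-zeros : ∀ m {g : ℕ → ℕ} → (∀ k → k ≤ m → g k ≡ 0) → sumTo m g ≡ 0
sumTo-zeros m e = trans (sumTo-cong m e) (zeros m)
  where
  zeros : ∀ m → sumTo m (λ _ → 0) ≡ 0
  zeros zero    = refl
  zeros (suc m) = cong (_+ 0) (zeros m)

sumTo-truncate : ∀ n m {g : ℕ → ℕ} → n ≤ m → (∀ k → n < k → g k ≡ 0) → sumTo m g ≡ sumTo n g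
sumTo-truncate n m n≤m z with m≤n⇒m<n∨m≡n n≤m
sumTo-truncate n (suc m) n≤1+m z | inj₁ n<1+m =
  trans (cong₂ _+_ (sumTo-truncate n m (≤-pred n<1+m) z) (z (suc m) n<1+m)) (+-identityʳ _)
... | inj₂ refl = refl

sumTo-distribˡ : ∀ m c (g : ℕ → ℕ) → sumTo m (λ d → c * g d) ≡ c * sumTo m g
sumTo-distribˡ zero    c g = refl
sumTo-distribˡ (suc m) c g = trans (cong (_+ c * g (suc m)) (sumTo-distribˡ m c g)) (sym (*-distribˡ-+ c _ _))

-- Ballot and Catalan numbers

walks : ℕ → ℕ → ℕ
walks zero    zero    = 1
walks zero    (suc h) = 0
walks (suc L) zero    = walks L 1
walks (suc L) (suc h) = walks L (suc (suc h)) + walks L h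

walks-< : ∀ {L h} → L < h → walks L h ≡ 0
walks-< {zero}  {suc h} _           = refl
walks-< {suc L} {suc h} (s≤s L<h) =
  cong₂ _+_ (walks-< (m<n⇒m<1+n (m<n⇒m<1+n L<h))) (walks-< L<h)

walks-diagonal : ∀ h → walks h h ≡ 1
walks-diagonal zero    = refl
walks-diagonal (suc h) = cong₂ _+_ (walks-< (m<n⇒m<1+n (n<1+n h))) (walks-diagonal h)

infixl 6.5 _C⁻_

_C⁻_ : ℕ → ℕ → ℕ
n C⁻ zero  = 0
n C⁻ suc u = n C u

pascal : ∀ n k → n C k + n C suc k ≡ suc n C suc k
pascal = nCk+nC[k+1]≡[n+1]C[k+1]

pascal⁻ : ∀ n u → n C⁻ u + n C u ≡ suc n C u
pascal⁻ n zero    = refl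
pascal⁻ n (suc u) = pascal n u

C-sym : ∀ {n} a b → n ≡ a + b → n C a ≡ n C b
C-sym a b refl = trans (nCk≡nC[n∸k] (m≤m+n a b)) (cong ((a + b) C_) (m+n∸m≡n a b))

-- The ballot theorem, with the subtracted binomial moved to the left.
walks-ballot : ∀ u h → walks (u + u + h) h + (u + u + h) C⁻ u ≡ (u + u + h) C u
walks-ballot zero    h       = trans (+-identityʳ _) (walks-diagonal h)
walks-ballot (suc u) zero    = subst Ballot (length-up u 0) (step-up (walks-ballot u 1))
  where
  Ballot : ℕ → Set
  Ballot L = walks L 0 + L C⁻ suc u ≡ L C suc u
  step-up : walks (u + u + 1) 1 + (u + u + 1) C⁻ u ≡ (u + u + 1) C u → Ballot (suc (u + u + 1))
  step-up ih = begin
    walks L 1 + suc L C u         ≡⟨ cong (walks L 1 +_) (sym (pascal⁻ L u)) ⟩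
    walks L 1 + (L C⁻ u + L C u)  ≡⟨ sym (+-assoc (walks L 1) _ _) ⟩
    (walks L 1 + L C⁻ u) + L C u  ≡⟨ cong (_+ L C u) ih ⟩
    L C u + L C u                 ≡⟨ cong (L C u +_) (C-sym u (suc u) (2u+1≡ u)) ⟩
    L C u + L C suc u             ≡⟨ pascal L u ⟩
    suc L C suc u                 ∎
    where
    L = u + u + 1
    2u+1≡ : ∀ u → u + u + 1 ≡ u + suc u
    2u+1≡ = solve-∀
  length-up : ∀ u h → suc (u + u + suc h) ≡ suc u + suc u + h
  length-up = solve-∀
walks-ballot (suc u) (suc h) =
  subst Ballot (length-up u h) (step (walks-ballot u (suc (suc h))) (walks-ballot (suc u) h))
  where
  Ballot : ℕ → Set
  Ballot L = walks L (suc h) + L C⁻ suc u ≡ L C suc u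
  L = suc u + suc u + h
  interchange : ∀ a b c d → (a + b) + (c + d) ≡ (a + c) + (b + d)
  interchange = solve-∀
  step : walks (u + u + suc (suc h)) (suc (suc h)) + (u + u + suc (suc h)) C⁻ u ≡ (u + u + suc (suc h)) C u →
         walks L h + L C⁻ suc u ≡ L C suc u → Ballot (suc L)
  step ih₁ ih₂ = begin
    (walks L (suc (suc h)) + walks L h) + suc L C u
      ≡⟨ cong ((walks L (suc (suc h)) + walks L h) +_) (sym (pascal⁻ L u)) ⟩
    (walks L (suc (suc h)) + walks L h) + (L C⁻ u + L C u)
      ≡⟨ interchange (walks L (suc (suc h))) (walks L h) (L C⁻ u) (L C u) ⟩
    (walks L (suc (suc h)) + L C⁻ u) + (walks L h + L C u)
      ≡⟨ cong₂ _+_ (subst (λ N → walks N (suc (suc h)) + N C⁻ u ≡ N C u) (same-length u h) ih₁) ih₂ ⟩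
    L C u + L C suc u
      ≡⟨ pascal L u ⟩
    suc L C suc u ∎
    where
    same-length : ∀ u h → u + u + suc (suc h) ≡ suc u + suc u + h
    same-length = solve-∀
  length-up : ∀ u h → suc (suc u + suc u + h) ≡ suc u + suc u + suc h
  length-up = solve-∀

[1+k]*[1+n]C[1+k]≡[1+n]*nCk : ∀ n k → suc k * (suc n C suc k) ≡ suc n * (n C k)
[1+k]*[1+n]C[1+k]≡[1+n]*nCk zero zero = refl
[1+k]*[1+n]C[1+k]≡[1+n]*nCk zero (suc k) = begin
  suc (suc k) * (1 C suc (suc k)) ≡⟨ cong (suc (suc k) *_) (k>n⇒nCk≡0 {1} {suc (suc k)} (s≤s (s≤s z≤n))) ⟩
  suc (suc k) * 0                 ≡⟨ *-zeroʳ (suc (suc k)) ⟩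
  0                               ≡⟨ cong (1 *_) (k>n⇒nCk≡0 {0} {suc k} (s≤s z≤n)) ⟨
  1 * (0 C suc k)                 ∎
[1+k]*[1+n]C[1+k]≡[1+n]*nCk (suc n) zero =
  trans (+-identityʳ _) (trans (nC1≡n (suc (suc n))) (sym (*-identityʳ (suc (suc n)))))
[1+k]*[1+n]C[1+k]≡[1+n]*nCk (suc n) (suc k) = begin
  suc (suc k) * (suc (suc n) C suc (suc k))           ≡⟨ cong (suc (suc k) *_) (pascal (suc n) (suc k)) ⟨
  suc (suc k) * (A + B)                               ≡⟨ *-distribˡ-+ (suc (suc k)) A B ⟩
  (A + suc k * A) + suc (suc k) * B                   ≡⟨ cong₂ (λ X Y → (A + X) + Y) ([1+k]*[1+n]C[1+k]≡[1+n]*nCk n k)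
                                                                                ([1+k]*[1+n]C[1+k]≡[1+n]*nCk n (suc k)) ⟩
  (A + suc n * (n C k)) + suc n * (n C suc k)         ≡⟨ +-assoc A (suc n * (n C k)) (suc n * (n C suc k)) ⟩
  A + (suc n * (n C k) + suc n * (n C suc k))         ≡⟨ cong (A +_) (*-distribˡ-+ (suc n) (n C k) (n C suc k)) ⟨
  A + suc n * (n C k + n C suc k)                     ≡⟨ cong (λ X → A + suc n * X) (pascal n k) ⟩
  suc (suc n) * A                                     ∎
  where
  A = suc n C suc k
  B = suc n C suc (suc k)

[1+u]*2uC⁻u≡u*2uCu : ∀ u → suc u * ((u + u) C⁻ u) ≡ u * ((u + u) C u)
[1+u]*2uC⁻u≡u*2uCu zero    = refl
[1+u]*2uC⁻u≡u*2uCu (suc v) = begin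
  suc (suc v) * (suc n C v)             ≡⟨ cong (suc (suc v) *_) (C-sym v (suc (suc v)) (2v+2≡ v)) ⟩
  suc (suc v) * (suc n C suc (suc v))   ≡⟨ [1+k]*[1+n]C[1+k]≡[1+n]*nCk n (suc v) ⟩
  suc n * (n C suc v)                   ≡⟨ cong (suc n *_) (C-sym v (suc v) refl) ⟨
  suc n * (n C v)                       ≡⟨ [1+k]*[1+n]C[1+k]≡[1+n]*nCk n v ⟨
  suc v * (suc n C suc v)               ∎
  where
  n = v + suc v
  2v+2≡ : ∀ v → suc (v + suc v) ≡ v + suc (suc v)
  2v+2≡ = solve-∀

[1+u]*walks≡2uCu : ∀ u → suc u * walks (u + u) 0 ≡ (u + u) C u
[1+u]*walks≡2uCu u = +-cancelʳ-≡ _ _ _ (begin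
  suc u * w + suc u * (N C⁻ u)  ≡⟨ *-distribˡ-+ (suc u) w (N C⁻ u) ⟨
  suc u * (w + N C⁻ u)          ≡⟨ cong (suc u *_) ballot ⟩
  N C u + u * (N C u)           ≡⟨ cong (N C u +_) ([1+u]*2uC⁻u≡u*2uCu u) ⟨
  N C u + suc u * (N C⁻ u)      ∎)
  where
  N = u + u
  w = walks N 0
  ballot : w + N C⁻ u ≡ N C u
  ballot = subst (λ L → walks L 0 + L C⁻ u ≡ L C u) (+-identityʳ N) (walks-ballot u 0)

catalan≡walks : ∀ u → catalan u ≡ walks (u + u) 0
catalan≡walks u = begin
  catalan u                          ≡⟨ cong (λ N → (N C u) / suc u) (cong (u +_) (+-identityʳ u)) ⟩
  ((u + u) C u) / suc u              ≡⟨ cong (_/ suc u) ([1+u]*walks≡2uCu u) ⟨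
  (suc u * walks (u + u) 0) / suc u  ≡⟨ cong (_/ suc u) (*-comm (suc u) (walks (u + u) 0)) ⟩
  (walks (u + u) 0 * suc u) / suc u  ≡⟨ m*n/n≡m (walks (u + u) 0) (suc u) ⟩
  walks (u + u) 0                    ∎

-- Colored walks

mutual
  coloredWalks : ℕ → ℕ → ℕ → ℕ
  coloredWalks zero    zero    zero    = 1
  coloredWalks zero    zero    (suc k) = 0
  coloredWalks zero    (suc h) k       = 0
  coloredWalks (suc L) zero    k       = coloredWalks L 1 k
  coloredWalks (suc L) (suc h) k       =
    coloredWalks L (suc (suc h)) k + (coloredWalks L h k + markedUDDWalks L h k)

  markedUDDWalks : ℕ → ℕ → ℕ → ℕ
  markedUDDWalks (suc (suc L)) h (suc k) = coloredWalks L h k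
  markedUDDWalks _             _ _       = 0

mutual
  coloredWalks-short : ∀ {L h k} → L < k + k + h → coloredWalks L h k ≡ 0
  coloredWalks-short {zero}  {zero}  {suc k} _ = refl
  coloredWalks-short {zero}  {suc h}         _ = refl
  coloredWalks-short {suc L} {zero}  {k}     L<2k =
    coloredWalks-short (<-trans (n<1+n L) (<-≤-trans L<2k (+-monoʳ-≤ (k + k) z≤n)))
  coloredWalks-short {suc L} {suc h} {k}     1+L<2k+1+h =
    cong₂ _+_ (coloredWalks-short (<-≤-trans L<2k+h (+-monoʳ-≤ (k + k) (m≤n⇒m≤1+n (n≤1+n h)))))
              (cong₂ _+_ (coloredWalks-short L<2k+h) (markedUDDWalks-short L<2k+h))
    where
    L<2k+h : L < k + k + h
    L<2k+h = ≤-pred (≤-trans 1+L<2k+1+h (≤-reflexive (+-suc (k + k) h)))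

  markedUDDWalks-short : ∀ {L h k} → L < k + k + h → markedUDDWalks L h k ≡ 0
  markedUDDWalks-short {zero}              _ = refl
  markedUDDWalks-short {suc zero}          _ = refl
  markedUDDWalks-short {suc (suc L)} {h} {zero}  _ = refl
  markedUDDWalks-short {suc (suc L)} {h} {suc k} 2+L<2k+2+h =
    coloredWalks-short (≤-pred (≤-pred (≤-trans 2+L<2k+2+h (≤-reflexive (2k+2+h≡ k h)))))
    where
    2k+2+h≡ : ∀ k h → suc k + suc k + h ≡ suc (suc (k + k + h))
    2k+2+h≡ = solve-∀

markedUDDWalks-zero : ∀ L h → markedUDDWalks L h 0 ≡ 0
markedUDDWalks-zero zero                h = refl
markedUDDWalks-zero (suc zero)          h = refl
markedUDDWalks-zero (suc (suc L))       h = refl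

coloredWalks-step : ∀ ℓ u h k →
  coloredWalks (ℓ + (k + k)) (suc (suc h)) k ≡ ((u + suc h) C k) * walks ℓ (suc (suc h)) →
  coloredWalks (ℓ + (k + k)) h k ≡ ((u + h) C k) * walks ℓ h →
  markedUDDWalks (ℓ + (k + k)) h k ≡ ((u + h) C⁻ k) * walks ℓ h →
  coloredWalks (suc ℓ + (k + k)) (suc h) k ≡ ((u + suc h) C k) * walks (suc ℓ) (suc h)
coloredWalks-step ℓ u h k up flat marked = begin
  coloredWalks (suc ℓ + (k + k)) (suc h) k
    ≡⟨ cong₂ _+_ up (cong₂ _+_ flat marked) ⟩
  X * walks₁ + (((u + h) C k) * walks₂ + ((u + h) C⁻ k) * walks₂)
    ≡⟨ cong (X * walks₁ +_) (*-distribʳ-+ walks₂ ((u + h) C k) _) ⟨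
  X * walks₁ + ((u + h) C k + (u + h) C⁻ k) * walks₂
    ≡⟨ cong (λ Y → X * walks₁ + Y * walks₂) pascal-shifted ⟩
  X * walks₁ + X * walks₂
    ≡⟨ *-distribˡ-+ X walks₁ walks₂ ⟨
  X * walks (suc ℓ) (suc h) ∎
  where
  X = (u + suc h) C k
  walks₁ = walks ℓ (suc (suc h))
  walks₂ = walks ℓ h
  pascal-shifted : (u + h) C k + (u + h) C⁻ k ≡ X
  pascal-shifted = trans (+-comm ((u + h) C k) _) (trans (pascal⁻ (u + h) k) (cong (_C k) (sym (+-suc u h))))

-- Expanding k of the u + h down steps of a walk into marked UDDs.
coloredWalks≡C*walks : ∀ ℓ u h k → ℓ ≡ u + u + h → coloredWalks (ℓ + (k + k)) h k ≡ ((u + h) C k) * walks ℓ h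
coloredWalks≡C*walks zero    zero    zero    zero    refl = refl
coloredWalks≡C*walks zero    zero    zero    (suc k) refl = coloredWalks-short (m≤m+n (suc (k + suc k)) 1)
coloredWalks≡C*walks (suc ℓ) (suc u) zero    k       eq   =
  trans (coloredWalks≡C*walks ℓ u 1 k (suc-injective (trans eq (2u+2≡ u))))
        (cong (λ Y → (Y C k) * walks ℓ 1) (trans (+-comm u 1) (sym (+-identityʳ (suc u)))))
  where
  2u+2≡ : ∀ u → suc u + suc u + 0 ≡ suc (u + u + 1)
  2u+2≡ = solve-∀
coloredWalks≡C*walks (suc ℓ) u       (suc h) k       eq   =
  coloredWalks-step ℓ u h k (up u ℓ≡) (coloredWalks≡C*walks ℓ u h k ℓ≡) (marked k)
  where
  ℓ≡ : ℓ ≡ u + u + h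
  ℓ≡ = suc-injective (trans eq (+-suc (u + u) h))
  up : ∀ u → ℓ ≡ u + u + h →
       coloredWalks (ℓ + (k + k)) (suc (suc h)) k ≡ ((u + suc h) C k) * walks ℓ (suc (suc h))
  up zero    ℓ≡h = begin
    coloredWalks (ℓ + (k + k)) (suc (suc h)) k
      ≡⟨ coloredWalks-short (subst (λ x → x + (k + k) < k + k + suc (suc h)) (sym ℓ≡h) (short h k)) ⟩
    0
      ≡⟨ *-zeroʳ (suc h C k) ⟨
    (suc h C k) * 0
      ≡⟨ cong ((suc h C k) *_) (walks-< (subst (_< suc (suc h)) (sym ℓ≡h) (m<n⇒m<1+n (n<1+n h)))) ⟨
    (suc h C k) * walks ℓ (suc (suc h)) ∎
    where
    short : ∀ h k → h + (k + k) < k + k + suc (suc h)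
    short h k = ≤-trans (n≤1+n _) (≤-reflexive (length≡ h k))
      where
      length≡ : ∀ h k → suc (suc (h + (k + k))) ≡ k + k + suc (suc h)
      length≡ = solve-∀
  up (suc u) ℓ≡′ =
    trans (coloredWalks≡C*walks ℓ u (suc (suc h)) k (trans ℓ≡′ (shift u h)))
          (cong (λ Y → (Y C k) * walks ℓ (suc (suc h))) (+-suc u (suc h)))
    where
    shift : ∀ u h → suc u + suc u + h ≡ u + u + suc (suc h)
    shift = solve-∀
  marked : ∀ k → markedUDDWalks (ℓ + (k + k)) h k ≡ ((u + h) C⁻ k) * walks ℓ h
  marked zero    = markedUDDWalks-zero (ℓ + 0) h
  marked (suc k) = trans (cong (λ L → markedUDDWalks L h (suc k)) (length≡ ℓ k))
                         (coloredWalks≡C*walks ℓ u h k ℓ≡)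
    where
    length≡ : ∀ ℓ k → ℓ + (suc k + suc k) ≡ suc (suc (ℓ + (k + k)))
    length≡ = solve-∀

sum-coloredWalks≡aFormula : ∀ n → sumTo (n + n) (coloredWalks (n + n) 0) ≡ aFormula n
sum-coloredWalks≡aFormula n =
  trans (sumTo-truncate n (n + n) (m≤m+n n n) (λ k n<k → coloredWalks-short (too-long n<k)))
        (sumTo-cong n term)
  where
  too-long : ∀ {k} → n < k → n + n < k + k + 0
  too-long {k} n<k = ≤-trans (+-mono-≤ n<k (<⇒≤ n<k)) (≤-reflexive (sym (+-identityʳ (k + k))))
  term : ∀ k → k ≤ n → coloredWalks (n + n) 0 k ≡ ((n ∸ k) C k) * catalan (n ∸ k)
  term k k≤n = begin
    coloredWalks (n + n) 0 k                  ≡⟨ cong (λ L → coloredWalks L 0 k) length≡ ⟩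
    coloredWalks (u + u + (k + k)) 0 k        ≡⟨ coloredWalks≡C*walks (u + u) u 0 k (sym (+-identityʳ (u + u))) ⟩
    ((u + 0) C k) * walks (u + u) 0            ≡⟨ cong₂ (λ a b → (a C k) * b) (+-identityʳ u) (sym (catalan≡walks u)) ⟩
    (u C k) * catalan u                        ∎
    where
    u = n ∸ k
    length≡ : n + n ≡ u + u + (k + k)
    length≡ = trans (cong (λ x → x + x) (sym (m∸n+n≡m k≤n))) (interchange u k)
      where
      interchange : ∀ u k → (u + k) + (u + k) ≡ u + u + (k + k)
      interchange = solve-∀

walkFrom : ℕ → ℕ → List Step → Bool
walkFrom L h p = dyckFrom h p ∧ (length p ≡ᵇ L)

ColoredWalk : ℕ → ℕ → ℕ → Set
ColoredWalk L h k =
  Σ (List Step) λ p → T (walkFrom L h p) × Σ (Vec Bool (countUDD p)) λ v → count T? v ≡ k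

MarkedUDDWalk : ℕ → ℕ → ℕ → Set
MarkedUDDWalk L h k =
  Σ (List Step) λ r → T (walkFrom (suc L) (suc h) (U ∷ D ∷ D ∷ r)) × Σ (Vec Bool (countUDD r)) λ v → count T? (true ∷ v) ≡ k

¬T[b∧false] : ∀ b → ¬ T (b ∧ false)
¬T[b∧false] true  ()
¬T[b∧false] false ()

unmarkedU : (q : List Step) → Vec Bool (countUDD q) → Vec Bool (countUDD (U ∷ q))
unmarkedU (D ∷ D ∷ r) v = false ∷ v
unmarkedU []          v = v
unmarkedU (U ∷ s)     v = v
unmarkedU (D ∷ [])    v = v
unmarkedU (D ∷ U ∷ s) v = v

count-unmarkedU : ∀ q v → count T? (unmarkedU q v) ≡ count T? v
count-unmarkedU (D ∷ D ∷ r) v = refl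
count-unmarkedU []          v = refl
count-unmarkedU (U ∷ s)     v = refl
count-unmarkedU (D ∷ [])    v = refl
count-unmarkedU (D ∷ U ∷ s) v = refl

-- dyckFrom matches on the height first, so the two heights are separate clauses.
prependU : ∀ {L h k} → ColoredWalk L (suc h) k → ColoredWalk (suc L) h k
prependU {h = zero}  (q , pv , v , pk) = U ∷ q , pv , unmarkedU q v , trans (count-unmarkedU q v) pk
prependU {h = suc _} (q , pv , v , pk) = U ∷ q , pv , unmarkedU q v , trans (count-unmarkedU q v) pk

ColoredWalk-ground↔ : ∀ {L k} → ColoredWalk (suc L) 0 k ↔ ColoredWalk L 1 k
ColoredWalk-ground↔ {L} {k} = mk↔ₛ′ dropU prependU dropU∘prependU prependU∘dropU
  where
  dropU : ColoredWalk (suc L) 0 k → ColoredWalk L 1 k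
  dropU (U ∷ []          , pv , c) = [] , pv , c
  dropU (U ∷ U ∷ s       , pv , c) = U ∷ s , pv , c
  dropU (U ∷ D ∷ []      , pv , c) = D ∷ [] , pv , c
  dropU (U ∷ D ∷ U ∷ s   , pv , c) = D ∷ U ∷ s , pv , c
  dropU (U ∷ D ∷ D ∷ r   , ()  , _)
  dropU (D ∷ q           , ()  , _)
  dropU ([]              , ()  , _)
  dropU∘prependU : ∀ w → dropU (prependU w) ≡ w
  dropU∘prependU ([]        , pv , c) = refl
  dropU∘prependU (U ∷ s     , pv , c) = refl
  dropU∘prependU (D ∷ []    , pv , c) = refl
  dropU∘prependU (D ∷ U ∷ s , pv , c) = refl
  dropU∘prependU (D ∷ D ∷ r , () , c)
  prependU∘dropU : ∀ w → prependU (dropU w) ≡ w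
  prependU∘dropU (U ∷ []        , pv , c) = refl
  prependU∘dropU (U ∷ U ∷ s     , pv , c) = refl
  prependU∘dropU (U ∷ D ∷ []    , pv , c) = refl
  prependU∘dropU (U ∷ D ∷ U ∷ s , pv , c) = refl
  prependU∘dropU (U ∷ D ∷ D ∷ r , () , _)
  prependU∘dropU (D ∷ q         , () , _)
  prependU∘dropU ([]            , () , _)

-- A marked UDD acts as a single down step of length three.
ColoredWalk-raised↔ : ∀ {L h k} → ColoredWalk (suc L) (suc h) k ↔
  (ColoredWalk L (suc (suc h)) k ⊎ (ColoredWalk L h k ⊎ MarkedUDDWalk L h k))
ColoredWalk-raised↔ {L} {h} {k} = mk↔ₛ′ split join split∘join join∘split
  where
  split : ColoredWalk (suc L) (suc h) k → ColoredWalk L (suc (suc h)) k ⊎ (ColoredWalk L h k ⊎ MarkedUDDWalk L h k)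
  split (D ∷ q                 , pv , c)            = inj₂ (inj₁ (q , pv , c))
  split (U ∷ []                , pv , c)            = inj₁ ([] , pv , c)
  split (U ∷ U ∷ s             , pv , c)            = inj₁ (U ∷ s , pv , c)
  split (U ∷ D ∷ []            , pv , c)            = inj₁ (D ∷ [] , pv , c)
  split (U ∷ D ∷ U ∷ s         , pv , c)            = inj₁ (D ∷ U ∷ s , pv , c)
  split (U ∷ D ∷ D ∷ r         , pv , false ∷ v , pk) = inj₁ (D ∷ D ∷ r , pv , v , pk)
  split (U ∷ D ∷ D ∷ r         , pv , true ∷ v , pk)  = inj₂ (inj₂ (r , pv , v , pk))
  split ([]                    , () , _)
  join : ColoredWalk L (suc (suc h)) k ⊎ (ColoredWalk L h k ⊎ MarkedUDDWalk L h k) → ColoredWalk (suc L) (suc h) k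
  join (inj₁ w)                        = prependU w
  join (inj₂ (inj₁ (q , pv , c)))      = D ∷ q , pv , c
  join (inj₂ (inj₂ (r , pv , v , pk))) = U ∷ D ∷ D ∷ r , pv , true ∷ v , pk
  split∘join : ∀ w → split (join w) ≡ w
  split∘join (inj₁ ([]          , pv , c)) = refl
  split∘join (inj₁ (U ∷ s       , pv , c)) = refl
  split∘join (inj₁ (D ∷ []      , pv , c)) = refl
  split∘join (inj₁ (D ∷ U ∷ s   , pv , c)) = refl
  split∘join (inj₁ (D ∷ D ∷ r   , pv , c)) = refl
  split∘join (inj₂ (inj₁ _))               = refl
  split∘join (inj₂ (inj₂ _))               = refl
  join∘split : ∀ w → join (split w) ≡ w
  join∘split (D ∷ q                 , pv , c)              = refl
  join∘split (U ∷ []                , pv , c)              = refl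
  join∘split (U ∷ U ∷ s             , pv , c)              = refl
  join∘split (U ∷ D ∷ []            , pv , c)              = refl
  join∘split (U ∷ D ∷ U ∷ s         , pv , c)              = refl
  join∘split (U ∷ D ∷ D ∷ r         , pv , false ∷ v , pk) = refl
  join∘split (U ∷ D ∷ D ∷ r         , pv , true ∷ v , pk)  = refl
  join∘split ([]                    , () , _)

MarkedUDDWalk↔ColoredWalk : ∀ {L h k} → MarkedUDDWalk (suc (suc L)) h (suc k) ↔ ColoredWalk L h k
MarkedUDDWalk↔ColoredWalk = mk↔ₛ′
  (λ (r , pv , v , e) → r , pv , v , suc-injective e)
  (λ (r , pv , v , e) → r , pv , v , cong suc e)
  (λ (r , pv , v , e) → cong (λ e′ → r , pv , v , e′) (≡-irrelevant _ _))
  (λ (r , pv , v , e) → cong (λ e′ → r , pv , v , e′) (≡-irrelevant _ _))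

ColoredWalk-empty↔ : ColoredWalk 0 0 0 ↔ Fin 1
ColoredWalk-empty↔ = mk↔ₛ′ (λ _ → Fin.zero) (λ _ → [] , _ , [] , refl) (λ { Fin.zero → refl ; (Fin.suc ()) }) unique
  where
  unique : ∀ w → ([] , _ , [] , refl) ≡ w
  unique ([]    , _  , [] , refl) = refl
  unique (U ∷ q , pv , _)         = ⊥-elim (¬T[b∧false] (dyckFrom 1 q) pv)
  unique (D ∷ q , () , _)

mutual
  ColoredWalk↔Fin : ∀ L h k → ColoredWalk L h k ↔ Fin (coloredWalks L h k)
  ColoredWalk↔Fin zero    zero    zero    = ColoredWalk-empty↔
  ColoredWalk↔Fin zero    zero    (suc k) = ¬⇒↔Fin0 λ
    { ([]    , _  , [] , ())
    ; (U ∷ q , pv , _)       → ¬T[b∧false] (dyckFrom 1 q) pv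
    ; (D ∷ q , () , _) }
  ColoredWalk↔Fin zero    (suc h) k       = ¬⇒↔Fin0 λ
    { ([]    , () , _)
    ; (U ∷ q , pv , _) → ¬T[b∧false] (dyckFrom (suc (suc h)) q) pv
    ; (D ∷ q , pv , _) → ¬T[b∧false] (dyckFrom h q) pv }
  ColoredWalk↔Fin (suc L) zero    k       = ↔-trans ColoredWalk-ground↔ (ColoredWalk↔Fin L 1 k)
  ColoredWalk↔Fin (suc L) (suc h) k       = ↔-trans ColoredWalk-raised↔
    (⊎↔Fin+ (ColoredWalk↔Fin L (suc (suc h)) k) (⊎↔Fin+ (ColoredWalk↔Fin L h k) (MarkedUDDWalk↔Fin L h k)))

  MarkedUDDWalk↔Fin : ∀ L h k → MarkedUDDWalk L h k ↔ Fin (markedUDDWalks L h k)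
  MarkedUDDWalk↔Fin (suc (suc L)) h (suc k) = ↔-trans (MarkedUDDWalk↔ColoredWalk {L} {h} {k}) (ColoredWalk↔Fin L h k)
  MarkedUDDWalk↔Fin zero          h k       = ¬⇒↔Fin0 λ (r , pv , _) → ¬T[b∧false] (dyckFrom h r) pv
  MarkedUDDWalk↔Fin (suc zero)    h k       = ¬⇒↔Fin0 λ (r , pv , _) → ¬T[b∧false] (dyckFrom h r) pv
  MarkedUDDWalk↔Fin (suc (suc L)) h zero    = ¬⇒↔Fin0 λ { (r , pv , v , ()) }

countUDD≤length : ∀ p → countUDD p ≤ length p
countUDD≤length []              = z≤n
countUDD≤length (U ∷ D ∷ D ∷ s) = s≤s (m≤n⇒m≤1+n (countUDD≤length (D ∷ s)))
countUDD≤length (U ∷ [])        = z≤n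
countUDD≤length (U ∷ U ∷ s)     = m≤n⇒m≤1+n (countUDD≤length (U ∷ s))
countUDD≤length (U ∷ D ∷ [])    = m≤n⇒m≤1+n (countUDD≤length (D ∷ []))
countUDD≤length (U ∷ D ∷ U ∷ s) = m≤n⇒m≤1+n (countUDD≤length (D ∷ U ∷ s))
countUDD≤length (D ∷ s)         = m≤n⇒m≤1+n (countUDD≤length s)

isDyck≡walkFrom : ∀ n p → isDyckOfSemilength n p ≡ walkFrom (n + n) 0 p
isDyck≡walkFrom n p =
  trans (∧-comm (length p ≡ᵇ 2 * n) _) (cong (λ L → dyckFrom 0 p ∧ (length p ≡ᵇ L)) (cong (n +_) (+-identityʳ n)))

ColoredDyckPath↔Σ : ∀ n → ColoredDyckPath n ↔ Σ ℕ (λ k → k ≤ n + n × ColoredWalk (n + n) 0 k)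
ColoredDyckPath↔Σ n = mk↔ₛ′ to from to∘from from∘to
  where
  to : ColoredDyckPath n → Σ ℕ (λ k → k ≤ n + n × ColoredWalk (n + n) 0 k)
  to ((p , isDyck) , v) = count T? v , count≤2n , p , pv , v , refl
    where
    pv = subst T (isDyck≡walkFrom n p) isDyck
    count≤2n = ≤-trans (count≤n T? v)
                       (≤-trans (countUDD≤length p) (≤-reflexive (≡ᵇ⇒≡ _ _ (T∧ʳ (dyckFrom 0 p) pv))))
  from : Σ ℕ (λ k → k ≤ n + n × ColoredWalk (n + n) 0 k) → ColoredDyckPath n
  from (k , _ , p , pv , v , _) = (p , subst T (sym (isDyck≡walkFrom n p)) pv) , v
  to∘from : ∀ x → to (from x) ≡ x
  to∘from (k , _ , p , pv , v , refl) = cong₂ (λ le pv′ → k , le , p , pv′ , v , refl) (≤-irrelevant _ _) (T-irrelevant _ _)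
  from∘to : ∀ x → from (to x) ≡ x
  from∘to ((p , isDyck) , v) = cong (λ d → (p , d) , v) (T-irrelevant _ _)

ColoredDyckPath↔Fin : ∀ n → ColoredDyckPath n ↔ Fin (aFormula n)
ColoredDyckPath↔Fin n = ↔-trans (ColoredDyckPath↔Σ n)
  (subst (λ N → Σ ℕ (λ k → k ≤ n + n × ColoredWalk (n + n) 0 k) ↔ Fin N) (sum-coloredWalks≡aFormula n)
         (Σ≤↔Fin-sumTo (n + n) (ColoredWalk↔Fin (n + n) 0)))

_∈ᵇ_ : ℕ → List ℕ → Bool
v ∈ᵇ w = any (λ x → x ≡ᵇ v) w

usesAll : ℕ → List ℕ → Bool
usesAll zero    w = true
usesAll (suc m) w = (m ∈ᵇ w) ∧ usesAll m w

initialRun : List ℕ → ℕ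
initialRun []          = 0
initialRun (x ∷ [])    = 1
initialRun (x ∷ y ∷ r) = if y <ᵇ x then suc (initialRun (y ∷ r)) else 1

placeAt : ℕ → ℕ → List ℕ → List ℕ
placeAt zero    M w       = M ∷ w
placeAt (suc p) M []      = M ∷ []
placeAt (suc p) M (x ∷ w) = x ∷ placeAt p M w

deleteAll : ℕ → List ℕ → List ℕ
deleteAll M []      = []
deleteAll M (x ∷ w) = if x ≡ᵇ M then deleteAll M w else x ∷ deleteAll M w

indexOf : ℕ → List ℕ → ℕ
indexOf M []      = 0
indexOf M (x ∷ w) = if x ≡ᵇ M then 0 else suc (indexOf M w)

repeatsAtHead : ℕ → List ℕ → Bool
repeatsAtHead M []      = false
repeatsAtHead M (x ∷ w) = (x ≡ᵇ M) ∧ (M ∈ᵇ w)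

module _ {M : ℕ} where

  ∈ᵇ-fresh : ∀ {w} → All (_< M) w → (M ∈ᵇ w) ≡ false
  ∈ᵇ-fresh []           = refl
  ∈ᵇ-fresh (x<M ∷ x<Ms) rewrite <⇒≡ᵇ≡false x<M = ∈ᵇ-fresh x<Ms

  deleteAll-fresh : ∀ {w} → All (_< M) w → deleteAll M w ≡ w
  deleteAll-fresh []                 = refl
  deleteAll-fresh {x ∷ w} (x<M ∷ x<Ms) rewrite <⇒≡ᵇ≡false x<M = cong (x ∷_) (deleteAll-fresh x<Ms)

  deleteAll-placeAt : ∀ p {w} → All (_< M) w → deleteAll M (placeAt p M w) ≡ w
  deleteAll-placeAt zero    w<M rewrite ≡ᵇ-refl M = deleteAll-fresh w<M
  deleteAll-placeAt (suc p) []  rewrite ≡ᵇ-refl M = refl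
  deleteAll-placeAt (suc p) {x ∷ w} (x<M ∷ w<M) rewrite <⇒≡ᵇ≡false x<M = cong (x ∷_) (deleteAll-placeAt p w<M)

  ∈ᵇ-placeAt : ∀ p w → (M ∈ᵇ placeAt p M w) ≡ true
  ∈ᵇ-placeAt zero    w       rewrite ≡ᵇ-refl M = refl
  ∈ᵇ-placeAt (suc p) []      rewrite ≡ᵇ-refl M = refl
  ∈ᵇ-placeAt (suc p) (x ∷ w) with x ≡ᵇ M
  ... | true  = refl
  ... | false = ∈ᵇ-placeAt p w

  ∈ᵇ-placeAt⁺ : ∀ {v} p w → T (v ∈ᵇ w) → T (v ∈ᵇ placeAt p M w)
  ∈ᵇ-placeAt⁺ {v} zero    w       v∈w with M ≡ᵇ v
  ... | true  = _
  ... | false = v∈w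
  ∈ᵇ-placeAt⁺ {v} (suc p) (x ∷ w) v∈w with x ≡ᵇ v
  ... | true  = _
  ... | false = ∈ᵇ-placeAt⁺ p w v∈w

  usesAll-placeAt : ∀ m p w → T (usesAll m w) → T (usesAll m (placeAt p M w))
  usesAll-placeAt zero    p w _    = _
  usesAll-placeAt (suc m) p w uses =
    T∧ (∈ᵇ-placeAt⁺ p w (T∧ˡ (m ∈ᵇ w) uses)) (usesAll-placeAt m p w (T∧ʳ (m ∈ᵇ w) uses))

  All-placeAt : ∀ p {w} → All (_< M) w → All (_< suc M) (placeAt p M w)
  All-placeAt zero    w<M         = ≤-refl ∷ All.map m<n⇒m<1+n w<M
  All-placeAt (suc p) []          = ≤-refl ∷ []
  All-placeAt (suc p) (x<M ∷ w<M) = m<n⇒m<1+n x<M ∷ All-placeAt p w<M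

  repeatsAtHead-placeAt : ∀ p {w} → All (_< M) w → repeatsAtHead M (placeAt p M w) ≡ false
  repeatsAtHead-placeAt zero    w<M        rewrite ≡ᵇ-refl M = ∈ᵇ-fresh w<M
  repeatsAtHead-placeAt (suc p) []         rewrite ≡ᵇ-refl M = refl
  repeatsAtHead-placeAt (suc p) (x<M ∷ _) rewrite <⇒≡ᵇ≡false x<M = refl

  repeatsAtHead-double : ∀ p w → repeatsAtHead M (M ∷ placeAt p M w) ≡ true
  repeatsAtHead-double p w rewrite ≡ᵇ-refl M = ∈ᵇ-placeAt p w

  length-placeAt : ∀ p w → length (placeAt p M w) ≡ suc (length w)
  length-placeAt zero    w       = refl
  length-placeAt (suc p) []      = refl
  length-placeAt (suc p) (x ∷ w) = cong suc (length-placeAt p w)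

usesAll-suc-placeAt : ∀ m p w → T (usesAll m w) → T (usesAll (suc m) (placeAt p m w))
usesAll-suc-placeAt m p w uses = T∧ (≡true⇒T (∈ᵇ-placeAt p w)) (usesAll-placeAt m p w uses)

initialRun-tail : ∀ p x w → suc p ≤ initialRun (x ∷ w) → p ≤ initialRun w
initialRun-tail zero    x w       _ = z≤n
initialRun-tail (suc p) x []      (s≤s ())
initialRun-tail (suc p) x (y ∷ r) run with y <ᵇ x
... | true  = ≤-pred run
... | false with run
... | s≤s ()

module _ {M : ℕ} where

  noneAbove-fresh : ∀ {w} → All (_< M) w → any (λ z → M ≤ᵇ z) w ≡ false
  noneAbove-fresh []          = refl
  noneAbove-fresh (x<M ∷ w<M) rewrite <⇒≤ᵇ≡false x<M = noneAbove-fresh w<M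

  hasUp2From-fresh : ∀ {w} → All (_< M) w → hasUp2From M w ≡ false
  hasUp2From-fresh []          = refl
  hasUp2From-fresh (y<M ∷ w<M) rewrite <⇒≤ᵇ≡false y<M = hasUp2From-fresh w<M

  -- The entries before the new maximum form a strict descent below z ≤ x.
  hasUp2From-placeAt : ∀ p x z {w} → hasUp2From x w ≡ false → All (_< M) w →
                       suc p ≤ initialRun (z ∷ w) → z ≤ x → hasUp2From x (placeAt p M w) ≡ false
  hasUp2From-placeAt zero x z w-free w<M _ _ rewrite noneAbove-fresh w<M | ∧-zeroʳ (x ≤ᵇ M) = w-free
  hasUp2From-placeAt (suc p) x z {[]}    _      _         (s≤s ())
  hasUp2From-placeAt (suc p) x z {y ∷ w} w-free (_ ∷ w<M) run z≤x with y <ᵇ z in y<ᵇz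
  ... | false with run
  ... | s≤s ()
  hasUp2From-placeAt (suc p) x z {y ∷ w} w-free (_ ∷ w<M) run z≤x | true
    rewrite <⇒≤ᵇ≡false {x} {y} (≤-trans (<ᵇ⇒< y z (≡true⇒T y<ᵇz)) z≤x) =
    hasUp2From-placeAt p x y (∨-conicalʳ _ _ w-free) w<M (≤-pred run) (<⇒≤ (≤-trans (<ᵇ⇒< y z (≡true⇒T y<ᵇz)) z≤x))

  containsStop-placeAt : ∀ p {w} → containsStop w ≡ false → All (_< M) w → p ≤ initialRun w →
                         containsStop (placeAt p M w) ≡ false
  containsStop-placeAt zero    w-free w<M _ rewrite hasUp2From-fresh w<M = w-free
  containsStop-placeAt (suc p) {x ∷ w} w-free (_ ∷ w<M) run =
    ∨≡false (hasUp2From-placeAt p x x (∨-conicalˡ _ _ w-free) w<M run ≤-refl)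
            (containsStop-placeAt p (∨-conicalʳ _ _ w-free) w<M (initialRun-tail p x w run))

  hasUp2From-fresh-placeAt : ∀ p {w} → All (_< M) w → hasUp2From M (placeAt p M w) ≡ false
  hasUp2From-fresh-placeAt zero    w<M rewrite noneAbove-fresh w<M | ∧-zeroʳ (M ≤ᵇ M) = hasUp2From-fresh w<M
  hasUp2From-fresh-placeAt (suc p) []  rewrite ∧-zeroʳ (M ≤ᵇ M) = refl
  hasUp2From-fresh-placeAt (suc p) (y<M ∷ w<M) rewrite <⇒≤ᵇ≡false y<M = hasUp2From-fresh-placeAt p w<M

  containsStop-double : ∀ p {w} → containsStop w ≡ false → All (_< M) w → p ≤ initialRun w →
                        containsStop (M ∷ placeAt p M w) ≡ false
  containsStop-double p w-free w<M run =
    ∨≡false (hasUp2From-fresh-placeAt p w<M) (containsStop-placeAt p w-free w<M run)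

module _ {M : ℕ} where

  initialRun-front : ∀ {w} → All (_< M) w → initialRun (M ∷ w) ≡ suc (initialRun w)
  initialRun-front []        = refl
  initialRun-front (y<M ∷ _) rewrite <⇒<ᵇ≡true y<M = refl

  initialRun-placeAt-∷ : ∀ p x w → All (_< M) (x ∷ w) → suc p ≤ initialRun (x ∷ w) →
                         initialRun (x ∷ placeAt p M w) ≡ suc p
  initialRun-placeAt-∷ zero x w (x<M ∷ _) _ rewrite ≤⇒<ᵇ≡false (<⇒≤ x<M) = refl
  initialRun-placeAt-∷ (suc p) x []      _     (s≤s ())
  initialRun-placeAt-∷ (suc p) x (y ∷ w) x∷w<M run with y <ᵇ x
  ... | false with run
  ... | s≤s ()
  initialRun-placeAt-∷ (suc p) x (y ∷ w) (_ ∷ y∷w<M) run | true =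
    cong suc (initialRun-placeAt-∷ p y w y∷w<M (≤-pred run))

  initialRun-placeAt : ∀ p {w} → All (_< M) w → suc p ≤ initialRun w → initialRun (placeAt (suc p) M w) ≡ suc p
  initialRun-placeAt p {x ∷ w} w<M run = initialRun-placeAt-∷ p x w w<M run

  initialRun-double : ∀ p {w} → All (_< M) w → p ≤ initialRun w → initialRun (M ∷ placeAt p M w) ≡ suc p
  initialRun-double zero    _   _ rewrite ≤⇒<ᵇ≡false (≤-refl {M}) = refl
  initialRun-double (suc p) {x ∷ w} (x<M ∷ w<M) run rewrite <⇒<ᵇ≡true x<M =
    cong suc (initialRun-placeAt-∷ p x w (x<M ∷ w<M) run)

initialRun-∷≤ : ∀ {b} x r → x < b → initialRun (x ∷ r) ≤ b
initialRun-∷≤ x []      x<b = ≤-trans (s≤s z≤n) x<b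
initialRun-∷≤ x (y ∷ r) x<b with y <ᵇ x in y<ᵇx
... | true  = ≤-trans (s≤s (initialRun-∷≤ y r (<ᵇ⇒< y x (≡true⇒T y<ᵇx)))) x<b
... | false = ≤-trans (s≤s z≤n) x<b

initialRun≤ : ∀ {M w} → All (_< M) w → initialRun w ≤ M
initialRun≤ []        = z≤n
initialRun≤ {w = x ∷ w} (x<M ∷ _) = initialRun-∷≤ x w x<M

initialRun-∷≥1 : ∀ x w → 1 ≤ initialRun (x ∷ w)
initialRun-∷≥1 x []      = ≤-refl
initialRun-∷≥1 x (y ∷ r) with y <ᵇ x
... | true  = s≤s z≤n
... | false = ≤-refl

module _ {M : ℕ} where

  any-deleteAll : ∀ (P : ℕ → Bool) w → any P w ≡ false → any P (deleteAll M w) ≡ false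
  any-deleteAll P []      _    = refl
  any-deleteAll P (y ∷ w) none with y ≡ᵇ M
  ... | true  = any-deleteAll P w (∨-conicalʳ _ _ none)
  ... | false = ∨≡false (∨-conicalˡ _ _ none) (any-deleteAll P w (∨-conicalʳ _ _ none))

  hasUp2From-deleteAll : ∀ x w → hasUp2From x w ≡ false → hasUp2From x (deleteAll M w) ≡ false
  hasUp2From-deleteAll x []      _    = refl
  hasUp2From-deleteAll x (y ∷ w) none with y ≡ᵇ M
  ... | true  = hasUp2From-deleteAll x w (∨-conicalʳ _ _ none)
  ... | false = ∨≡false (pair (x ≤ᵇ y) (∨-conicalˡ _ _ none)) (hasUp2From-deleteAll x w (∨-conicalʳ _ _ none))
    where
    pair : ∀ a → (a ∧ any (y ≤ᵇ_) w) ≡ false → (a ∧ any (y ≤ᵇ_) (deleteAll M w)) ≡ false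
    pair false _    = refl
    pair true  none = any-deleteAll (y ≤ᵇ_) w none

  containsStop-deleteAll : ∀ w → containsStop w ≡ false → containsStop (deleteAll M w) ≡ false
  containsStop-deleteAll []      _    = refl
  containsStop-deleteAll (x ∷ w) free with x ≡ᵇ M
  ... | true  = containsStop-deleteAll w (∨-conicalʳ _ _ free)
  ... | false = ∨≡false (hasUp2From-deleteAll x w (∨-conicalˡ _ _ free)) (containsStop-deleteAll w (∨-conicalʳ _ _ free))

  <suc∧≢⇒< : ∀ {x} → x < suc M → (x ≡ᵇ M) ≡ false → x < M
  <suc∧≢⇒< x<1+M x≢M with m≤n⇒m<n∨m≡n (≤-pred x<1+M)
  ... | inj₁ x<M  = x<M
  ... | inj₂ refl = ⊥-elim (subst T x≢M (≡true⇒T (≡ᵇ-refl M)))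

  All-deleteAll : ∀ {w} → All (_< suc M) w → All (_< M) (deleteAll M w)
  All-deleteAll []                  = []
  All-deleteAll {x ∷ w} (x<1+M ∷ w<1+M) with x ≡ᵇ M in x≟M
  ... | true  = All-deleteAll w<1+M
  ... | false = <suc∧≢⇒< x<1+M x≟M ∷ All-deleteAll w<1+M

  All-absent : ∀ {w} → All (_< suc M) w → (M ∈ᵇ w) ≡ false → All (_< M) w
  All-absent []                  _      = []
  All-absent {x ∷ w} (x<1+M ∷ w<1+M) absent =
    <suc∧≢⇒< x<1+M (∨-conicalˡ _ _ absent) ∷ All-absent w<1+M (∨-conicalʳ _ _ absent)

  ∈ᵇ-deleteAll : ∀ {v} w → v ≢ M → T (v ∈ᵇ w) → T (v ∈ᵇ deleteAll M w)
  ∈ᵇ-deleteAll {v} (x ∷ w) v≢M v∈w with x ≡ᵇ M in x≟M | x ≡ᵇ v in x≟v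
  ... | true  | true  = ⊥-elim (v≢M (trans (sym (≡ᵇ⇒≡ x v (≡true⇒T x≟v))) (≡ᵇ⇒≡ x M (≡true⇒T x≟M))))
  ... | true  | false = ∈ᵇ-deleteAll w v≢M v∈w
  ... | false | true  = subst (λ b → T (b ∨ v ∈ᵇ deleteAll M w)) (sym x≟v) _
  ... | false | false = subst (λ b → T (b ∨ v ∈ᵇ deleteAll M w)) (sym x≟v) (∈ᵇ-deleteAll w v≢M v∈w)

  usesAll-deleteAll : ∀ j w → j ≤ M → T (usesAll j w) → T (usesAll j (deleteAll M w))
  usesAll-deleteAll zero    w _   _    = _
  usesAll-deleteAll (suc j) w j<M uses =
    T∧ (∈ᵇ-deleteAll w (λ j≡M → <-irrefl j≡M j<M) (T∧ˡ (j ∈ᵇ w) uses))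
       (usesAll-deleteAll j w (<⇒≤ j<M) (T∧ʳ (j ∈ᵇ w) uses))

  length-deleteAll : ∀ w → length (deleteAll M w) ≤ length w
  length-deleteAll []      = z≤n
  length-deleteAll (y ∷ w) with y ≡ᵇ M
  ... | true  = m≤n⇒m≤1+n (length-deleteAll w)
  ... | false = s≤s (length-deleteAll w)

  length-deleteAll-∈ : ∀ w → T (M ∈ᵇ w) → length (deleteAll M w) < length w
  length-deleteAll-∈ (x ∷ w) M∈w with x ≡ᵇ M
  ... | true  = s≤s (length-deleteAll w)
  ... | false = s≤s (length-deleteAll-∈ w M∈w)

usesAll⇒≤length : ∀ m w → T (usesAll m w) → m ≤ length w
usesAll⇒≤length zero    w _    = z≤n
usesAll⇒≤length (suc m) w uses = ≤-trans
  (s≤s (usesAll⇒≤length m (deleteAll m w) (usesAll-deleteAll m w ≤-refl (T∧ʳ (m ∈ᵇ w) uses))))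
  (length-deleteAll-∈ w (T∧ˡ (m ∈ᵇ w) uses))

∈ᵇ⇒someAbove : ∀ {v y} r → T (v ∈ᵇ r) → y ≤ v → any (y ≤ᵇ_) r ≡ true
∈ᵇ⇒someAbove {v} {y} (x ∷ r) v∈r y≤v with x ≡ᵇ v in x≟v
... | true rewrite ≡ᵇ⇒≡ x v (≡true⇒T x≟v) | ≤⇒≤ᵇ≡true y≤v = refl
... | false with y ≤ᵇ x
...   | true  = refl
...   | false = ∈ᵇ⇒someAbove r v∈r y≤v

hasUp2From-witness : ∀ {x y v} r → x ≤ y → y ≤ v → T (v ∈ᵇ r) → hasUp2From x (y ∷ r) ≡ true
hasUp2From-witness r x≤y y≤v v∈r rewrite ≤⇒≤ᵇ≡true x≤y | ∈ᵇ⇒someAbove r v∈r y≤v = refl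

¬stop-pattern : ∀ {x y v} r → containsStop (x ∷ y ∷ r) ≡ false → x ≤ y → y ≤ v → T (v ∈ᵇ r) → ⊥
¬stop-pattern {x} {y} r free x≤y y≤v v∈r =
  subst T (∨-conicalˡ _ _ free) (≡true⇒T (hasUp2From-witness r x≤y y≤v v∈r))

module _ {M : ℕ} where

  repeatsAtHead-tail : ∀ x r → x ≤ M → containsStop (x ∷ r) ≡ false → repeatsAtHead M r ≡ false
  repeatsAtHead-tail x []      _   _    = refl
  repeatsAtHead-tail x (y ∷ r) x≤M free with y ≡ᵇ M in y≟M | M ∈ᵇ r in M∈r
  ... | false | _     = refl
  ... | true  | false = refl
  ... | true  | true  = ⊥-elim (¬stop-pattern r free (subst (x ≤_) (sym y≡M) x≤M) (≤-reflexive y≡M) (≡true⇒T M∈r))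
    where y≡M = ≡ᵇ⇒≡ y M (≡true⇒T y≟M)

  indexOf≤initialRun-∷ : ∀ x r → x ≤ M → All (_< suc M) r → containsStop (x ∷ r) ≡ false → T (M ∈ᵇ r) →
                          indexOf M r ≤ initialRun (deleteAll M r) → suc (indexOf M r) ≤ initialRun (x ∷ deleteAll M r)
  indexOf≤initialRun-∷ x (y ∷ r) x≤M (y<1+M ∷ _) free M∈y∷r run with y ≡ᵇ M
  ... | true  = initialRun-∷≥1 x (deleteAll M r)
  ... | false with y <ᵇ x in y<ᵇx
  ...   | true  = s≤s run
  ...   | false = ⊥-elim (¬stop-pattern {x} r free (≮⇒≥ (λ y<x → subst T y<ᵇx (<⇒<ᵇ y<x))) (≤-pred y<1+M) M∈y∷r)

  single-max : ∀ w → All (_< suc M) w → containsStop w ≡ false → T (M ∈ᵇ w) → repeatsAtHead M w ≡ false →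
               w ≡ placeAt (indexOf M w) M (deleteAll M w) × indexOf M w ≤ initialRun (deleteAll M w)
  single-max (x ∷ r) (x<1+M ∷ r<1+M) free M∈w once with x ≡ᵇ M in x≟M
  ... | true rewrite ≡ᵇ⇒≡ x M (≡true⇒T x≟M) =
    cong (M ∷_) (sym (deleteAll-fresh (All-absent r<1+M once))) , z≤n
  ... | false =
    cong (x ∷_) (proj₁ ih) , indexOf≤initialRun-∷ x r (≤-pred x<1+M) r<1+M free M∈w (proj₂ ih)
    where
    ih = single-max r r<1+M (∨-conicalʳ _ _ free) M∈w (repeatsAtHead-tail x r (≤-pred x<1+M) free)

  double-max : ∀ x r → All (_< suc M) (x ∷ r) → containsStop (x ∷ r) ≡ false → repeatsAtHead M (x ∷ r) ≡ true →
               x ∷ r ≡ M ∷ placeAt (indexOf M r) M (deleteAll M r) × deleteAll M (x ∷ r) ≡ deleteAll M r ×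
               indexOf M r ≤ initialRun (deleteAll M r)
  double-max x r (_ ∷ r<1+M) free twice with x ≡ᵇ M in x≟M
  ... | true rewrite ≡ᵇ⇒≡ x M (≡true⇒T x≟M) = cong (M ∷_) (proj₁ s) , refl , proj₂ s
    where
    s = single-max r r<1+M (∨-conicalʳ _ _ free) (≡true⇒T twice) (repeatsAtHead-tail M r ≤-refl free)

-- Counting active words

when≤ : ℕ → ℕ → ℕ → ℕ
when≤ j d x = if j ≤ᵇ d then x else 0

when≤-≤ : ∀ {j d} x → j ≤ d → when≤ j d x ≡ x
when≤-≤ x j≤d rewrite ≤⇒≤ᵇ≡true j≤d = refl

when≤-> : ∀ {j d} x → d < j → when≤ j d x ≡ 0
when≤-> x d<j rewrite <⇒≤ᵇ≡false d<j = refl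

when≤-* : ∀ j d c x → when≤ j d (c * x) ≡ c * when≤ j d x
when≤-* j d c x with j ≤ᵇ d
... | true  = refl
... | false = sym (*-zeroʳ c)

sum-when≤-> : ∀ m {j} (g : ℕ → ℕ) → m < j → sumTo m (λ d → when≤ j d (g d)) ≡ 0
sum-when≤-> m g m<j = sumTo-zeros m (λ d d≤m → when≤-> (g d) (≤-<-trans d≤m m<j))

sum-when≤-step : ∀ {j} m (g : ℕ → ℕ) → j ≤ m →
                 sumTo m (λ d → when≤ j d (g d)) ≡ g j + sumTo m (λ d → when≤ (suc j) d (g d))
sum-when≤-step zero g z≤n = sym (+-identityʳ (g 0))
sum-when≤-step {j} (suc m) g j≤1+m with m≤n⇒m<n∨m≡n j≤1+m
... | inj₁ j<1+m = begin
  sumTo m (λ d → when≤ j d (g d)) + when≤ j (suc m) (g (suc m))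
    ≡⟨ cong₂ _+_ (sum-when≤-step m g (≤-pred j<1+m)) (when≤-≤ (g (suc m)) j≤1+m) ⟩
  (g j + sumTo m (λ d → when≤ (suc j) d (g d))) + g (suc m)
    ≡⟨ +-assoc (g j) _ _ ⟩
  g j + (sumTo m (λ d → when≤ (suc j) d (g d)) + g (suc m))
    ≡⟨ cong (λ x → g j + (sumTo m (λ d → when≤ (suc j) d (g d)) + x)) (when≤-≤ (g (suc m)) j<1+m) ⟨
  g j + sumTo (suc m) (λ d → when≤ (suc j) d (g d)) ∎
... | inj₂ refl = begin
  sumTo m (λ d → when≤ (suc m) d (g d)) + when≤ (suc m) (suc m) (g (suc m))
    ≡⟨ cong₂ _+_ (sum-when≤-> m g ≤-refl) (when≤-≤ (g (suc m)) (≤-refl {suc m})) ⟩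
  g (suc m)
    ≡⟨ +-identityʳ (g (suc m)) ⟨
  g (suc m) + 0
    ≡⟨ cong (g (suc m) +_) (sum-when≤-> (suc m) g ≤-refl) ⟨
  g (suc m) + sumTo (suc m) (λ d → when≤ (suc (suc m)) d (g d)) ∎

runCount : ℕ → ℕ → ℕ
runCount zero    zero     = 1
runCount zero    (suc d)  = 0
runCount (suc m) zero     = 0
runCount (suc m) (suc d′) = walks (m + m ∸ d′) d′

runCount-step : ∀ m j → j ≤ m → runCount m j + walks (m + m ∸ suc j) (suc j) ≡ walks (m + m ∸ j) j
runCount-step zero     zero     _           = refl
runCount-step (suc m′) zero     _           = refl
runCount-step (suc m′) (suc j′) (s≤s j′≤m′) = begin
  walks L j′ + walks (m′ + suc m′ ∸ suc j′) (suc (suc j′))  ≡⟨ cong (λ N → walks L j′ + walks N (suc (suc j′))) shorter ⟩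
  walks L j′ + walks L (suc (suc j′))                      ≡⟨ +-comm (walks L j′) _ ⟩
  walks (suc L) (suc j′)                                   ≡⟨ cong (λ N → walks N (suc j′)) longer ⟨
  walks (m′ + suc m′ ∸ j′) (suc j′)                        ∎
  where
  L = m′ + m′ ∸ j′
  shorter : m′ + suc m′ ∸ suc j′ ≡ L
  shorter = cong (_∸ suc j′) (+-suc m′ m′)
  longer : m′ + suc m′ ∸ j′ ≡ suc L
  longer = trans (cong (_∸ j′) (+-suc m′ m′)) (+-∸-assoc 1 (≤-trans j′≤m′ (m≤m+n m′ m′)))

sum-runCount-above : ∀ m j → m < j → sumTo m (λ d → when≤ j d (runCount m d)) ≡ walks (m + m ∸ j) j
sum-runCount-above m j m<j = trans (sum-when≤-> m (runCount m) m<j) (sym (walks-< (≤-<-trans too-short m<j)))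
  where
  too-short : m + m ∸ j ≤ m
  too-short = ≤-trans (∸-monoʳ-≤ (m + m) m<j) (≤-trans (∸-monoʳ-≤ (m + m) (n≤1+n m)) (≤-reflexive (m+n∸m≡n m m)))

sum-runCount-from : ∀ m i j → i + j ≡ suc m → sumTo m (λ d → when≤ j d (runCount m d)) ≡ walks (m + m ∸ j) j
sum-runCount-from m zero    .(suc m) refl  = sum-runCount-above m (suc m) ≤-refl
sum-runCount-from m (suc i) j       i+j≡m = begin
  sumTo m (λ d → when≤ j d (runCount m d))
    ≡⟨ sum-when≤-step m (runCount m) j≤m ⟩
  runCount m j + sumTo m (λ d → when≤ (suc j) d (runCount m d))
    ≡⟨ cong (runCount m j +_) (sum-runCount-from m i (suc j) (trans (+-suc i j) i+j≡m)) ⟩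
  runCount m j + walks (m + m ∸ suc j) (suc j)
    ≡⟨ runCount-step m j j≤m ⟩
  walks (m + m ∸ j) j ∎
  where
  j≤m : j ≤ m
  j≤m = ≤-pred (≤-trans (m≤n+m (suc j) i) (≤-reflexive (trans (+-suc i j) i+j≡m)))

sum-runCount-≥ : ∀ m j → sumTo m (λ d → when≤ j d (runCount m d)) ≡ walks (m + m ∸ j) j
sum-runCount-≥ m j with j ≤? m
... | yes j≤m = sum-runCount-from m (suc m ∸ j) j (m∸n+n≡m (m≤n⇒m≤1+n j≤m))
... | no  j≰m = sum-runCount-above m j (≰⇒> j≰m)

sum-runCount : ∀ m → sumTo m (runCount m) ≡ catalan m
sum-runCount m = trans (sum-runCount-≥ m 0) (sym (catalan≡walks m))

mutual
  activeWords : ℕ → ℕ → ℕ → ℕ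
  activeWords zero    zero    zero     = 1
  activeWords zero    zero    (suc d)  = 0
  activeWords zero    (suc k) d        = 0
  activeWords (suc m) k       zero     = 0
  activeWords (suc m) k       (suc d′) = sumTo m (λ d → when≤ d′ d (activeWords m k d + doubledWords m k d))

  doubledWords : ℕ → ℕ → ℕ → ℕ
  doubledWords m zero    d = 0
  doubledWords m (suc k) d = activeWords m k d

mutual
  activeWords≡ : ∀ m k d → activeWords m k d ≡ (m C k) * runCount m d
  activeWords≡ zero    zero    zero     = refl
  activeWords≡ zero    zero    (suc d)  = refl
  activeWords≡ zero    (suc k) d        = refl
  activeWords≡ (suc m) k       zero     = sym (*-zeroʳ (suc m C k))
  activeWords≡ (suc m) k       (suc d′) = begin
    sumTo m (λ d → when≤ d′ d (activeWords m k d + doubledWords m k d))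
      ≡⟨ sumTo-cong m (λ d _ → cong (when≤ d′ d) (both d)) ⟩
    sumTo m (λ d → when≤ d′ d ((suc m C k) * runCount m d))
      ≡⟨ sumTo-cong m (λ d _ → when≤-* d′ d (suc m C k) (runCount m d)) ⟩
    sumTo m (λ d → (suc m C k) * when≤ d′ d (runCount m d))
      ≡⟨ sumTo-distribˡ m (suc m C k) _ ⟩
    (suc m C k) * sumTo m (λ d → when≤ d′ d (runCount m d))
      ≡⟨ cong ((suc m C k) *_) (sum-runCount-≥ m d′) ⟩
    (suc m C k) * walks (m + m ∸ d′) d′ ∎
    where
    both : ∀ d → activeWords m k d + doubledWords m k d ≡ (suc m C k) * runCount m d
    both d = begin
      activeWords m k d + doubledWords m k d         ≡⟨ cong₂ _+_ (activeWords≡ m k d) (doubledWords≡ m k d) ⟩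
      (m C k) * runCount m d + (m C⁻ k) * runCount m d ≡⟨ *-distribʳ-+ (runCount m d) (m C k) (m C⁻ k) ⟨
      (m C k + m C⁻ k) * runCount m d                ≡⟨ cong (_* runCount m d) (trans (+-comm (m C k) _) (pascal⁻ m k)) ⟩
      (suc m C k) * runCount m d                     ∎

  doubledWords≡ : ∀ m k d → doubledWords m k d ≡ (m C⁻ k) * runCount m d
  doubledWords≡ m zero    d = refl
  doubledWords≡ m (suc k) d = activeWords≡ m k d

sum-activeWords : ∀ m k → sumTo m (activeWords m k) ≡ (m C k) * catalan m
sum-activeWords m k = begin
  sumTo m (activeWords m k)              ≡⟨ sumTo-cong m (λ d _ → activeWords≡ m k d) ⟩
  sumTo m (λ d → (m C k) * runCount m d) ≡⟨ sumTo-distribˡ m (m C k) (runCount m) ⟩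
  (m C k) * sumTo m (runCount m)         ≡⟨ cong ((m C k) *_) (sum-runCount m) ⟩
  (m C k) * catalan m                    ∎

sum-activeWords≡aFormula : ∀ n → sumTo n (λ k → sumTo (n ∸ k) (activeWords (n ∸ k) k)) ≡ aFormula n
sum-activeWords≡aFormula n = sumTo-cong n (λ k _ → sum-activeWords (n ∸ k) k)

record IsActive (m k d : ℕ) (w : List ℕ) : Set where
  constructor active
  field
    bounded : All (_< m) w
    covers  : T (usesAll m w)
    free    : containsStop w ≡ false
    length≡ : length w ≡ m + k
    run≡    : initialRun w ≡ d

open IsActive

IsActive-irrelevant : ∀ {m k d w} (a b : IsActive m k d w) → a ≡ b
IsActive-irrelevant (active b₁ c₁ f₁ l₁ r₁) (active b₂ c₂ f₂ l₂ r₂)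
  rewrite All.irrelevant <-irrelevant b₁ b₂ | T-irrelevant c₁ c₂ | Decidable⇒UIP.≡-irrelevant Bool._≟_ f₁ f₂
        | ≡-irrelevant l₁ l₂ | ≡-irrelevant r₁ r₂ = refl

ActiveWord : ℕ → ℕ → ℕ → Set
ActiveWord m k d = Σ (List ℕ) (IsActive m k d)

DoubledWord : ℕ → ℕ → ℕ → Set
DoubledWord m zero    d = ⊥
DoubledWord m (suc k) d = ActiveWord m k d

Pieces : ℕ → ℕ → ℕ → Set
Pieces m k d′ = Σ ℕ λ d → d ≤ m × d′ ≤ d × (ActiveWord m k d ⊎ DoubledWord m k d)

ActiveWord-≡ : ∀ {m k d w₁ w₂} {a₁ : IsActive m k d w₁} {a₂ : IsActive m k d w₂} →
               w₁ ≡ w₂ → _≡_ {A = ActiveWord m k d} (w₁ , a₁) (w₂ , a₂)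
ActiveWord-≡ {a₁ = a₁} {a₂} refl = cong (_ ,_) (IsActive-irrelevant a₁ a₂)

Pieces-≡ : ∀ {m k k′ d′} (ι : ∀ {d} → ActiveWord m k′ d → ActiveWord m k d ⊎ DoubledWord m k d)
           {d₁ d₂ w₁ w₂} {b₁ : d₁ ≤ m} {b₂ : d₂ ≤ m} {c₁ : d′ ≤ d₁} {c₂ : d′ ≤ d₂}
           {a₁ : IsActive m k′ d₁ w₁} {a₂ : IsActive m k′ d₂ w₂} →
           w₁ ≡ w₂ → _≡_ {A = Pieces m k d′} (d₁ , b₁ , c₁ , ι (w₁ , a₁)) (d₂ , b₂ , c₂ , ι (w₂ , a₂))
Pieces-≡ ι {b₁ = b₁} {b₂} {c₁} {c₂} {a₁} {a₂} refl with trans (sym (run≡ a₁)) (run≡ a₂)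
... | refl rewrite ≤-irrelevant b₁ b₂ | ≤-irrelevant c₁ c₂ | IsActive-irrelevant a₁ a₂ = refl

-- The position at which a fresh maximum turns an initial run of length d ≥ d′ into one of length d′ + 1.
slot : ℕ → ℕ → ℕ
slot d′ d = if d′ ≡ᵇ d then 0 else suc d′

module _ {M : ℕ} where

  initialRun-slot : ∀ {d′ d w} → All (_< M) w → d′ ≤ d → initialRun w ≡ d →
                    slot d′ d ≤ initialRun w × initialRun (placeAt (slot d′ d) M w) ≡ suc d′
  initialRun-slot {d′} {d} w<M d′≤d run≡d with d′ ≟ d
  ... | yes refl rewrite ≡ᵇ-refl d′ = z≤n , trans (initialRun-front w<M) (cong suc run≡d)
  ... | no d′≢d  rewrite ≢⇒≡ᵇ≡false d′ d d′≢d = inside , initialRun-placeAt d′ w<M inside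
    where
    inside = ≤-trans (≤∧≢⇒< d′≤d d′≢d) (≤-reflexive (sym run≡d))

  slot-initialRun : ∀ {d′} p {w} → All (_< M) w → p ≤ initialRun w → initialRun (placeAt p M w) ≡ suc d′ →
                    d′ ≤ initialRun w × slot d′ (initialRun w) ≡ p
  slot-initialRun {d′} zero {w} w<M _ run with suc-injective (trans (sym (initialRun-front w<M)) run)
  ... | refl rewrite ≡ᵇ-refl (initialRun w) = ≤-refl , refl
  slot-initialRun {d′} (suc q) {w} w<M q<run run with suc-injective (trans (sym (initialRun-placeAt q w<M q<run)) run)
  ... | refl rewrite ≢⇒≡ᵇ≡false q (initialRun w) (λ q≡run → <-irrefl q≡run q<run) = <⇒≤ q<run , refl

placeOnce-active : ∀ {m k d d′ w} → IsActive m k d w → d′ ≤ d → IsActive (suc m) k (suc d′) (placeAt (slot d′ d) m w)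
placeOnce-active {m} {k} {d} {d′} {w} a d′≤d = active
  (All-placeAt (slot d′ d) (bounded a))
  (usesAll-suc-placeAt m (slot d′ d) w (covers a))
  (containsStop-placeAt (slot d′ d) (free a) (bounded a) (proj₁ s))
  (trans (length-placeAt (slot d′ d) w) (cong suc (length≡ a)))
  (proj₂ s)
  where s = initialRun-slot (bounded a) d′≤d (run≡ a)

placeTwice-active : ∀ {m k d d′ w} → IsActive m k d w → d′ ≤ d → IsActive (suc m) (suc k) (suc d′) (m ∷ placeAt d′ m w)
placeTwice-active {m} {k} {d} {d′} {w} a d′≤d = active
  (≤-refl ∷ All-placeAt d′ (bounded a))
  (usesAll-placeAt (suc m) 0 (placeAt d′ m w) (usesAll-suc-placeAt m d′ w (covers a)))
  (containsStop-double d′ (free a) (bounded a) inside)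
  (cong suc (trans (length-placeAt d′ w) (trans (cong suc (length≡ a)) (sym (+-suc m k)))))
  (initialRun-double d′ (bounded a) inside)
  where inside = ≤-trans d′≤d (≤-reflexive (sym (run≡ a)))

placeMax : ∀ {m k d′} → Pieces m k d′ → ActiveWord (suc m) k (suc d′)
placeMax {m} {k}     {d′} (d , _ , d′≤d , inj₁ (w , a)) = placeAt (slot d′ d) m w , placeOnce-active a d′≤d
placeMax {m} {suc k} {d′} (d , _ , d′≤d , inj₂ (w , a)) = m ∷ placeAt d′ m w , placeTwice-active a d′≤d

removeOnce : ∀ {m k d′} w′ → IsActive (suc m) k (suc d′) w′ → repeatsAtHead m w′ ≡ false →
             let w = deleteAll m w′ in
             IsActive m k (initialRun w) w × d′ ≤ initialRun w × placeAt (slot d′ (initialRun w)) m w ≡ w′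
removeOnce {m} {k} {d′} w′ a once = activeRest , proj₁ slot≡ , trans (cong (λ q → placeAt q m w) (proj₂ slot≡)) (sym w′≡)
  where
  w = deleteAll m w′
  s = single-max w′ (bounded a) (free a) (T∧ˡ (m ∈ᵇ w′) (covers a)) once
  w′≡ = proj₁ s
  w<m = All-deleteAll (bounded a)
  slot≡ = slot-initialRun (indexOf m w′) w<m (proj₂ s) (subst (λ z → initialRun z ≡ suc d′) w′≡ (run≡ a))
  activeRest : IsActive m k (initialRun w) w
  activeRest = active w<m
    (usesAll-deleteAll m w′ ≤-refl (T∧ʳ (m ∈ᵇ w′) (covers a)))
    (containsStop-deleteAll w′ (free a))
    (suc-injective (trans (sym (length-placeAt (indexOf m w′) w)) (subst (λ z → length z ≡ suc m + k) w′≡ (length≡ a))))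
    refl

module RemoveTwice {m k d′ : ℕ} (x : ℕ) (r : List ℕ) (twice : repeatsAtHead m (x ∷ r) ≡ true)
                   (a : IsActive (suc m) k (suc d′) (x ∷ r)) where

  w = deleteAll m r

  private
    s = double-max x r (bounded a) (free a) twice
    rest≡ = proj₁ (proj₂ s)

  w<m : All (_< m) w
  w<m = subst (All (_< m)) rest≡ (All-deleteAll (bounded a))

  uses : T (usesAll m w)
  uses = subst (λ z → T (usesAll m z)) rest≡ (usesAll-deleteAll m (x ∷ r) ≤-refl (T∧ʳ (m ∈ᵇ (x ∷ r)) (covers a)))

  w-free : containsStop w ≡ false
  w-free = subst (λ z → containsStop z ≡ false) rest≡ (containsStop-deleteAll (x ∷ r) (free a))

  2+length≡ : suc (suc (length w)) ≡ suc m + k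
  2+length≡ = trans (cong suc (sym (length-placeAt (indexOf m r) w))) (subst (λ z → length z ≡ suc m + k) (proj₁ s) (length≡ a))

  index≡ : indexOf m r ≡ d′
  index≡ = suc-injective (trans (sym (initialRun-double (indexOf m r) w<m (proj₂ (proj₂ s))))
                               (subst (λ z → initialRun z ≡ suc d′) (proj₁ s) (run≡ a)))

  d′≤run : d′ ≤ initialRun w
  d′≤run = subst (_≤ initialRun w) index≡ (proj₂ (proj₂ s))

  x∷r≡ : m ∷ placeAt d′ m w ≡ x ∷ r
  x∷r≡ = sym (subst (λ q → x ∷ r ≡ m ∷ placeAt q m w) index≡ (proj₁ s))

removeTwice : ∀ {m k d′} x r → repeatsAtHead m (x ∷ r) ≡ true → IsActive (suc m) (suc k) (suc d′) (x ∷ r) →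
              let w = deleteAll m r in
              IsActive m k (initialRun w) w × d′ ≤ initialRun w × m ∷ placeAt d′ m w ≡ x ∷ r
removeTwice {m} {k} x r twice a =
  active w<m uses w-free (suc-injective (suc-injective (trans 2+length≡ (cong suc (+-suc m k))))) refl , d′≤run , x∷r≡
  where open RemoveTwice x r twice a

removeTwice-impossible : ∀ {m d′} x r → repeatsAtHead m (x ∷ r) ≡ true → ¬ IsActive (suc m) 0 (suc d′) (x ∷ r)
removeTwice-impossible {m} x r twice a =
  1+n≰n (≤-trans (s≤s (usesAll⇒≤length m w uses)) (≤-reflexive (suc-injective (trans 2+length≡ (cong suc (+-identityʳ m))))))
  where open RemoveTwice x r twice a

removeMax′ : ∀ {m k d′} w′ → IsActive (suc m) k (suc d′) w′ → (b : Bool) → repeatsAtHead m w′ ≡ b → Pieces m k d′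
removeMax′ {m} w′ a false once = let (a′ , d′≤d , _) = removeOnce w′ a once in
  initialRun (deleteAll m w′) , initialRun≤ (bounded a′) , d′≤d , inj₁ (deleteAll m w′ , a′)
removeMax′ {k = zero}  (x ∷ r) a true twice = ⊥-elim (removeTwice-impossible x r twice a)
removeMax′ {m} {k = suc k} (x ∷ r) a true twice = let (a′ , d′≤d , _) = removeTwice x r twice a in
  initialRun (deleteAll m r) , initialRun≤ (bounded a′) , d′≤d , inj₂ (deleteAll m r , a′)

removeMax : ∀ {m k d′} → ActiveWord (suc m) k (suc d′) → Pieces m k d′
removeMax {m} (w′ , a) = removeMax′ w′ a (repeatsAtHead m w′) refl

placeMax∘removeMax′ : ∀ {m k d′} w′ (a : IsActive (suc m) k (suc d′) w′) b (e : repeatsAtHead m w′ ≡ b) →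
                      placeMax (removeMax′ w′ a b e) ≡ (w′ , a)
placeMax∘removeMax′ w′ a false once = ActiveWord-≡ (proj₂ (proj₂ (removeOnce w′ a once)))
placeMax∘removeMax′ {k = zero}  (x ∷ r) a true twice = ⊥-elim (removeTwice-impossible x r twice a)
placeMax∘removeMax′ {k = suc k} (x ∷ r) a true twice = ActiveWord-≡ (proj₂ (proj₂ (removeTwice x r twice a)))

removeMax∘placeMax : ∀ {m k d′} (y : Pieces m k d′) → removeMax (placeMax y) ≡ y
removeMax∘placeMax {m} {k} {d′} (d , d≤m , d′≤d , inj₁ (w , a)) = once (repeatsAtHead m (placeAt (slot d′ d) m w)) refl
  where
  once : ∀ b (e : repeatsAtHead m (placeAt (slot d′ d) m w) ≡ b) →
         removeMax′ _ (placeOnce-active a d′≤d) b e ≡ (d , d≤m , d′≤d , inj₁ (w , a))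
  once false _ = Pieces-≡ inj₁ (deleteAll-placeAt (slot d′ d) (bounded a))
  once true  e = ⊥-elim (subst T (repeatsAtHead-placeAt (slot d′ d) (bounded a)) (≡true⇒T e))
removeMax∘placeMax {m} {suc k} {d′} (d , d≤m , d′≤d , inj₂ (w , a)) = twice (repeatsAtHead m (m ∷ placeAt d′ m w)) refl
  where
  twice : ∀ b (e : repeatsAtHead m (m ∷ placeAt d′ m w) ≡ b) →
          removeMax′ _ (placeTwice-active a d′≤d) b e ≡ (d , d≤m , d′≤d , inj₂ (w , a))
  twice true  _ = Pieces-≡ inj₂ (deleteAll-placeAt d′ (bounded a))
  twice false e = ⊥-elim (subst T e (≡true⇒T (repeatsAtHead-double d′ w)))

ActiveWord↔Pieces : ∀ {m k d′} → ActiveWord (suc m) k (suc d′) ↔ Pieces m k d′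
ActiveWord↔Pieces {m} = mk↔ₛ′ removeMax placeMax removeMax∘placeMax
  (λ (w′ , a) → placeMax∘removeMax′ w′ a (repeatsAtHead m w′) refl)

gated↔Fin : ∀ {Z : Set} {z} j d → Z ↔ Fin z → (j ≤ d × Z) ↔ Fin (when≤ j d z)
gated↔Fin j d φ with j ≤? d
... | yes j≤d = ↔-trans (mk↔ₛ′ proj₂ (j≤d ,_) (λ _ → refl) (λ (j≤d′ , _) → cong (_, _) (≤-irrelevant j≤d j≤d′)))
                        (subst (λ n → _ ↔ Fin n) (sym (when≤-≤ _ j≤d)) φ)
... | no  j≰d = subst (λ n → _ ↔ Fin n) (sym (when≤-> _ (≰⇒> j≰d))) (¬⇒↔Fin0 (λ (j≤d , _) → j≰d j≤d))

¬All<0 : ∀ {x w} → ¬ All (_< 0) (x ∷ w)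
¬All<0 (() ∷ _)

ActiveWord-empty↔ : ActiveWord 0 0 0 ↔ Fin 1
ActiveWord-empty↔ = mk↔ₛ′ (λ _ → Fin.zero) (λ _ → [] , active [] _ refl refl refl) (λ { Fin.zero → refl ; (Fin.suc ()) }) unique
  where
  unique : ∀ w → ([] , active [] _ refl refl refl) ≡ w
  unique ([] , a) = ActiveWord-≡ refl
  unique (x ∷ w , a) = ⊥-elim (¬All<0 (bounded a))

mutual
  ActiveWord↔Fin : ∀ m k d → ActiveWord m k d ↔ Fin (activeWords m k d)
  ActiveWord↔Fin zero    zero    zero     = ActiveWord-empty↔
  ActiveWord↔Fin zero    zero    (suc d)  = ¬⇒↔Fin0 λ { ([] , a) → 0≢1+n (run≡ a) ; (x ∷ w , a) → ¬All<0 (bounded a) }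
  ActiveWord↔Fin zero    (suc k) d        = ¬⇒↔Fin0 λ { ([] , a) → 0≢1+n (length≡ a) ; (x ∷ w , a) → ¬All<0 (bounded a) }
  ActiveWord↔Fin (suc m) k       zero     = ¬⇒↔Fin0 λ
    { ([] , a)    → covers a
    ; (x ∷ w , a) → 1+n≰n (≤-trans (initialRun-∷≥1 x w) (≤-reflexive (run≡ a))) }
  ActiveWord↔Fin (suc m) k       (suc d′) = ↔-trans ActiveWord↔Pieces
    (Σ≤↔Fin-sumTo m (λ d → gated↔Fin d′ d (⊎↔Fin+ (ActiveWord↔Fin m k d) (DoubledWord↔Fin m k d))))

  DoubledWord↔Fin : ∀ m k d → DoubledWord m k d ↔ Fin (doubledWords m k d)
  DoubledWord↔Fin m zero    d = ¬⇒↔Fin0 λ ()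
  DoubledWord↔Fin m (suc k) d = ActiveWord↔Fin m k d

-- Chains as block vectors

blockCount : List ℕ → ℕ
blockCount []      = 0
blockCount (x ∷ w) = suc x ⊔ blockCount w

All<blockCount : ∀ w → All (_< blockCount w) w
All<blockCount []      = []
All<blockCount (x ∷ w) =
  m≤m⊔n (suc x) (blockCount w) ∷ All.map (λ y<count → ≤-trans y<count (m≤n⊔m (suc x) (blockCount w))) (All<blockCount w)

blockCount≤ : ∀ {M w} → All (_< M) w → blockCount w ≤ M
blockCount≤ []          = z≤n
blockCount≤ (x<M ∷ w<M) = ⊔-lub x<M (blockCount≤ w<M)

∈ᵇ⇒<blockCount : ∀ v w → T (v ∈ᵇ w) → v < blockCount w
∈ᵇ⇒<blockCount v (x ∷ w) v∈w with x ≡ᵇ v in x≟v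
... | true rewrite ≡ᵇ⇒≡ x v (≡true⇒T x≟v) = m≤m⊔n (suc v) (blockCount w)
... | false = ≤-trans (∈ᵇ⇒<blockCount v w v∈w) (m≤n⊔m (suc x) (blockCount w))

usesAll⁺ : ∀ m w → (∀ v → v < m → T (v ∈ᵇ w)) → T (usesAll m w)
usesAll⁺ zero    w _   = _
usesAll⁺ (suc m) w has = T∧ (has m ≤-refl) (usesAll⁺ m w (λ v v<m → has v (m<n⇒m<1+n v<m)))

usesAll⁻ : ∀ m w → T (usesAll m w) → ∀ v → v < m → T (v ∈ᵇ w)
usesAll⁻ (suc m) w uses v v<1+m with v ≟ m
... | yes refl = T∧ˡ (m ∈ᵇ w) uses
... | no  v≢m  = usesAll⁻ m w (T∧ʳ (m ∈ᵇ w) uses) v (≤∧≢⇒< (≤-pred v<1+m) v≢m)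

blockCount-unique : ∀ m w → All (_< m) w → T (usesAll m w) → blockCount w ≡ m
blockCount-unique zero    w w<m _    = n≤0⇒n≡0 (blockCount≤ w<m)
blockCount-unique (suc m) w w<m uses = ≤-antisym (blockCount≤ w<m) (∈ᵇ⇒<blockCount m w (T∧ˡ (m ∈ᵇ w) uses))

All<⇒T-all : ∀ {n w} → All (_< n) w → T (all (λ x → x <ᵇ n) w)
All<⇒T-all w<n = all⁻ _ (All.map <⇒<ᵇ w<n)

T-all⇒All< : ∀ n w → T (all (λ x → x <ᵇ n) w) → All (_< n) w
T-all⇒All< n w all< = All.map (<ᵇ⇒< _ n) (all⁺ _ w all<)

orderedSetPartition⇒fills : ∀ n w → T (isOrderedSetPartition n w) → blockCount w ≤ n × T (usesAll (blockCount w) w)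
orderedSetPartition⇒fills n w osp = blockCount≤n , usesAll⁺ (blockCount w) w used
  where
  blockCount≤n = blockCount≤ (T-all⇒All< n w (T∧ˡ (all (λ x → x <ᵇ n) w) osp))
  filled = all⁺ _ (upTo n) (T∧ʳ (all (λ x → x <ᵇ n) w) osp)
  used : ∀ v → v < blockCount w → T (v ∈ᵇ w)
  used v v<count with Equivalence.to T-∨ (applyUpTo⁻ (λ x → x) n filled (<-≤-trans v<count blockCount≤n))
  ... | inj₁ v∈w  = v∈w
  ... | inj₂ w<v = ⊥-elim (<⇒≱ v<count (blockCount≤ (T-all⇒All< v w w<v)))

fills⇒orderedSetPartition : ∀ {n m w} → All (_< m) w → T (usesAll m w) → m ≤ n → T (isOrderedSetPartition n w)
fills⇒orderedSetPartition {n} {m} {w} w<m uses m≤n =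
  T∧ (All<⇒T-all (All.map (λ x<m → <-≤-trans x<m m≤n) w<m)) (all⁻ _ (applyUpTo⁺₁ (λ x → x) n filled))
  where
  filled : ∀ {v} → v < n → T (any (λ x → x ≡ᵇ v) w ∨ all (λ x → x <ᵇ v) w)
  filled {v} _ with v <? m
  ... | yes v<m = Equivalence.from T-∨ (inj₁ (usesAll⁻ m w uses v v<m))
  ... | no  v≮m = Equivalence.from T-∨ (inj₂ (All<⇒T-all (All.map (λ x<m → <-≤-trans x<m (≮⇒≥ v≮m)) w<m)))

fromList′ : ∀ {n} (w : List ℕ) → length w ≡ n → Vec ℕ n
fromList′ {zero}  []      _ = []
fromList′ {suc n} (x ∷ w) e = x ∷ fromList′ w (suc-injective e)

toList-fromList′ : ∀ {n} (w : List ℕ) (e : length w ≡ n) → toList (fromList′ w e) ≡ w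
toList-fromList′ {zero}  []      _ = refl
toList-fromList′ {suc n} (x ∷ w) e = cong (x ∷_) (toList-fromList′ w (suc-injective e))

fromList′-toList : ∀ {n} (v : Vec ℕ n) (e : length (toList v) ≡ n) → fromList′ (toList v) e ≡ v
fromList′-toList []      _ = refl
fromList′-toList (x ∷ v) e = cong (x ∷_) (fromList′-toList v (suc-injective e))

Words : ℕ → Set
Words n = Σ ℕ λ k → k ≤ n × Σ ℕ λ d → d ≤ n ∸ k × ActiveWord (n ∸ k) k d

Words-≡ : ∀ {n k₁ k₂ d₁ d₂ w₁ w₂} {b₁ : k₁ ≤ n} {b₂ : k₂ ≤ n} {c₁ : d₁ ≤ n ∸ k₁} {c₂ : d₂ ≤ n ∸ k₂}
          {a₁ : IsActive (n ∸ k₁) k₁ d₁ w₁} {a₂ : IsActive (n ∸ k₂) k₂ d₂ w₂} →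
          k₁ ≡ k₂ → w₁ ≡ w₂ → _≡_ {A = Words n} (k₁ , b₁ , d₁ , c₁ , w₁ , a₁) (k₂ , b₂ , d₂ , c₂ , w₂ , a₂)
Words-≡ {b₁ = b₁} {b₂} {c₁} {c₂} {a₁} {a₂} refl refl with trans (sym (run≡ a₁)) (run≡ a₂)
... | refl rewrite ≤-irrelevant b₁ b₂ | ≤-irrelevant c₁ c₂ | IsActive-irrelevant a₁ a₂ = refl

module _ (n : ℕ) where

  toWords : ActiveChain n → Words n
  toWords (b , t) = k , m∸n≤m n (blockCount w) , initialRun w , initialRun≤ (bounded a) , w , a
    where
    w = toList b
    fills = orderedSetPartition⇒fills n w (T∧ˡ (isOrderedSetPartition n w) t)
    k = n ∸ blockCount w
    n∸k≡blockCount : n ∸ k ≡ blockCount w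
    n∸k≡blockCount = m∸[m∸n]≡n (proj₁ fills)
    a : IsActive (n ∸ k) k (initialRun w) w
    a = active (subst (λ m → All (_< m) w) (sym n∸k≡blockCount) (All<blockCount w))
               (subst (λ m → T (usesAll m w)) (sym n∸k≡blockCount) (proj₂ fills))
               (Equivalence.to T-not-≡ (T∧ʳ (isOrderedSetPartition n w) t))
               (trans (length-toList b) (sym (m∸n+n≡m (m∸n≤m n (blockCount w)))))
               refl

  length≡n : ∀ {k d w} → k ≤ n → IsActive (n ∸ k) k d w → length w ≡ n
  length≡n k≤n a = trans (length≡ a) (m∸n+n≡m k≤n)

  fromWords : Words n → ActiveChain n
  fromWords (k , k≤n , d , _ , w , a) = fromList′ w (length≡n k≤n a) ,
    subst (λ z → T (isOrderedSetPartition n z ∧ not (containsStop z))) (sym (toList-fromList′ w (length≡n k≤n a)))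
          (T∧ (fills⇒orderedSetPartition (bounded a) (covers a) (m∸n≤m n k)) (Equivalence.from T-not-≡ (free a)))

  toWords∘fromWords : ∀ y → toWords (fromWords y) ≡ y
  toWords∘fromWords (k , k≤n , d , _ , w , a) = Words-≡ k≡ w≡
    where
    w≡ = toList-fromList′ w (length≡n k≤n a)
    k≡ : n ∸ blockCount (toList (fromList′ w (length≡n k≤n a))) ≡ k
    k≡ = trans (cong (λ z → n ∸ blockCount z) w≡)
               (trans (cong (n ∸_) (blockCount-unique (n ∸ k) w (bounded a) (covers a))) (m∸[m∸n]≡n k≤n))

  fromWords∘toWords : ∀ x → fromWords (toWords x) ≡ x
  fromWords∘toWords (b , _) = ActiveChain-≡ (fromList′-toList b _)
    where
    ActiveChain-≡ : ∀ {v₁ v₂ : Vec ℕ n} {t₁ t₂} → v₁ ≡ v₂ → _≡_ {A = ActiveChain n} (v₁ , t₁) (v₂ , t₂)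
    ActiveChain-≡ {t₁ = t₁} {t₂} refl = cong (_ ,_) (T-irrelevant t₁ t₂)

  ActiveChain↔Words : ActiveChain n ↔ Words n
  ActiveChain↔Words = mk↔ₛ′ toWords fromWords toWords∘fromWords fromWords∘toWords

ActiveChain↔Fin : ∀ n → ActiveChain n ↔ Fin (aFormula n)
ActiveChain↔Fin n = ↔-trans (ActiveChain↔Words n)
  (subst (λ N → Words n ↔ Fin N) (sum-activeWords≡aFormula n)
         (Σ≤↔Fin-sumTo n (λ k → Σ≤↔Fin-sumTo (n ∸ k) (ActiveWord↔Fin (n ∸ k) k))))

proposition6 : ((n : ℕ) → 1 ≤ n →
                  (ActiveChain n ↔ ColoredDyckPath n) × (ActiveChain n ↔ Fin (aFormula n)))
               × (map aFormula (1 ∷ 2 ∷ 3 ∷ 4 ∷ 5 ∷ 6 ∷ 7 ∷ 8 ∷ [])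
                    ≡ 1 ∷ 3 ∷ 9 ∷ 31 ∷ 113 ∷ 431 ∷ 1697 ∷ 6847 ∷ [])
-- Both counts equal a_n for every n.
proposition6 = (λ n _ → ↔-trans (ActiveChain↔Fin n) (↔-sym (ColoredDyckPath↔Fin n)) , ActiveChain↔Fin n) , refl
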